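{- Let $n,k,d\in\mathbb{N}$ satisfy $n\ge 60k$ and $k\ge 4d$. Suppose a tree $T$ with $n$ vertices has at most $n/(5d)$ leaves. Then $T$ either contains a $2d$-separated set of at least $n/(40k)$ leaves, or contains a collection of $n/(40k)$ vertex disjoint bare paths of length $k$.
   Context: A set $Q$ of vertices of $T$ is $k$-separated in $T$ if every two distinct vertices of $Q$ are at distance at least $k$ in $T$. A bare path in a tree is a path all of whose interior vertices have degree exactly $2$ in the tree; the length of a path is its number of edges. -}

module Defs where

open import Data.Nat using (ℕ; zero; suc; _+_; _*_; _∸_; _≤_)
open import Data.Bool using (Bool; true; false; T; if_then_else_)
open import Data.Fin using (Fin)
open import Data.Nat.ListAction using (sum)
open import Data.Empty using (⊥)
open import Data.List using (List; []; _∷_; length; map; allFin; take; drop; concat; last)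
open import Data.List.Relation.Unary.All using (All)
open import Data.List.Relation.Unary.Linked using (Linked)
open import Data.List.Relation.Unary.Unique.Propositional using (Unique)
open import Data.List.Membership.Propositional using (_∈_)
open import Data.Maybe using (Maybe; just; nothing)
open import Data.Product using (Σ; ∃; _×_; _,_)
open import Relation.Binary.PropositionalEquality using (_≡_; _≢_)
open import Relation.Nullary using (¬_)

Graph : ℕ → Set
Graph n = Fin n → Fin n → Bool

module _ {n : ℕ} (G : Graph n) where

  Adj : Fin n → Fin n → Set
  Adj u v = T (G u v)

  data Walk : Fin n → Fin n → ℕ → Set where
    here : ∀ {u} → Walk u u 0
    step : ∀ {u v w l} → Adj u v → Walk v w l → Walk u w (suc l)

  IsPath : List (Fin n) → Set
  IsPath xs = Unique xs × Linked Adj xs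

  IsCycle : List (Fin n) → Set
  IsCycle [] = ⊥
  IsCycle (x ∷ xs) =
    IsPath (x ∷ xs) × (2 ≤ length xs) × (∀ y → last (x ∷ xs) ≡ just y → Adj y x)

  IsTree : Set
  IsTree = (∀ u v → G u v ≡ G v u)
         × (∀ u → G u u ≡ false)
         × (∀ u v → ∃ λ l → Walk u v l)
         × (∀ xs → ¬ IsCycle xs)

  degree : Fin n → ℕ
  degree u = sum (map (λ v → if G u v then 1 else 0) (allFin n))

  IsLeaf : Fin n → Set
  IsLeaf u = degree u ≡ 1

  leafCount : ℕ
  leafCount = sum (map (λ u → if Data.Nat._≡ᵇ_ (degree u) 1 then 1 else 0) (allFin n))

  -- dist(u,v) ≥ k  ⇔  every walk from u to v has length ≥ k
  DistAtLeast : ℕ → Fin n → Fin n → Set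
  DistAtLeast k u v = ∀ l → Walk u v l → k ≤ l

  Separated : ℕ → List (Fin n) → Set
  Separated k Q = ∀ u v → u ∈ Q → v ∈ Q → u ≢ v → DistAtLeast k u v

  interior : List (Fin n) → List (Fin n)
  interior xs = take (length xs ∸ 2) (drop 1 xs)

  IsBarePath : ℕ → List (Fin n) → Set
  IsBarePath k xs = IsPath xs × (length xs ≡ suc k) × All (λ v → degree v ≡ 2) (interior xs)

-- Root the tree and split its non-root vertices into those of degree 2 and the others; a degree count
-- shows that there are at most twice as many of the others as there are leaves. The degree-2 vertices
-- form upward runs. With t = 2d − 2, call a vertex a cut if it is the (t+1)-st vertex of its run: the
-- t degree-2 vertices above a cut force every walk leaving its subtree to have length at least 2d, so
-- one leaf from each component of the tree cut at these vertices gives a 2d-separated set. A component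
-- without leaves has at least two cuts hanging below it, hence there are at most twice as many cuts as
-- chosen leaves. Beyond the cuts, runs are chopped into consecutive bare paths of length k; together
-- with the cuts their starting points account for all long-run vertices up to a factor k + 1, while short
-- runs contribute at most t vertices per run. This gives n ≤ 1 + 2L(t+1) + (k+1)(2q + s) for L leaves,
-- q chosen leaves and s bare paths, which is incompatible with both q and s being below n/(40k).

module Submission where

open import Defs
open import Data.Nat using (ℕ; _+_; _*_; _≤_)
open import Data.Fin using (Fin)
open import Data.List using (List; length; concat)
open import Data.List.Relation.Unary.All using (All)
open import Data.List.Relation.Unary.Unique.Propositional using (Unique)
open import Data.Product using (Σ; _×_)
open import Data.Sum using (_⊎_)

module Counting where
  open import Data.Nat hiding (_≟_)
  open import Data.Nat.Properties hiding (_≟_; suc-injective)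
  import Data.Nat.ListAction as List
  open import Data.Bool using (Bool; true; false; T; if_then_else_; not; _∧_)
  open import Data.Bool.Properties using (T?; T-∧)
  open import Data.Fin using (Fin; zero; suc; _≟_)
  open import Data.Fin.Properties using (suc-injective)
  open import Data.List using (List; []; _∷_; map; allFin; tabulate; filter; length)
  open import Data.List.Properties using (map-tabulate)
  open import Data.Empty using (⊥-elim)
  open import Data.Product using (_×_; _,_)
  open import Data.Sum using (_⊎_; inj₁; inj₂)
  open import Function using (_∘_; id)
  open import Function.Bundles using (Equivalence)
  open import Relation.Nullary using (¬_; does; yes; no)
  open import Relation.Binary.PropositionalEquality
  open import Algebra.Properties.CommutativeMonoid.Sum +-0-commutativeMonoid public
    using (sum; sum-syntax; sum-cong-≗; sum-replicate-zero; ∑-distrib-+; ∑-comm)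

  T-∧⁻ : ∀ a {b} → T (a ∧ b) → T a × T b
  T-∧⁻ a = Equivalence.to (T-∧ {a})

  T-∧⁺ : ∀ {a b} → T a → T b → T (a ∧ b)
  T-∧⁺ ta tb = Equivalence.from T-∧ (ta , tb)

  ¬T⇒T-not : ∀ {b} → ¬ T b → T (not b)
  ¬T⇒T-not {true} ¬b = ¬b _
  ¬T⇒T-not {false} _ = _

  T-not⇒¬T : ∀ {b} → T (not b) → ¬ T b
  T-not⇒¬T {true} ()

  if-true : ∀ {A : Set} {b} {x y : A} → T b → (if b then x else y) ≡ x
  if-true {b = true} _ = refl

  if-false : ∀ {A : Set} {b} {x y : A} → ¬ T b → (if b then x else y) ≡ y
  if-false {b = true} ¬b = ⊥-elim (¬b _)
  if-false {b = false} _ = refl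

  not-≤ᵇ⇒> : ∀ {m n} → T (not (m ≤ᵇ n)) → n < m
  not-≤ᵇ⇒> not-m≤n = ≰⇒> (T-not⇒¬T not-m≤n ∘ ≤⇒≤ᵇ)

  >⇒not-≤ᵇ : ∀ {m n} → n < m → T (not (m ≤ᵇ n))
  >⇒not-≤ᵇ {m} {n} n<m = ¬T⇒T-not (<⇒≱ n<m ∘ ≤ᵇ⇒≤ m n)

  _==_ : ∀ {n} → Fin n → Fin n → Bool
  i == j = does (i ≟ j)

  ==⇒≡ : ∀ {n} {i j : Fin n} → T (i == j) → i ≡ j
  ==⇒≡ {i = i} {j} _ with i ≟ j
  ... | yes i≡j = i≡j

  ≡⇒== : ∀ {n} {i j : Fin n} → i ≡ j → T (i == j)
  ≡⇒== {i = i} {j} i≡j with i ≟ j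
  ... | yes _ = _
  ... | no i≢j = i≢j i≡j

  not-==⇒≢ : ∀ {n} {i j : Fin n} → T (not (i == j)) → i ≢ j
  not-==⇒≢ {i = i} {j} _ i≡j with i ≟ j
  ... | no i≢j = i≢j i≡j

  ≢⇒not-== : ∀ {n} {i j : Fin n} → i ≢ j → T (not (i == j))
  ≢⇒not-== {i = i} {j} i≢j with i ≟ j
  ... | yes i≡j = i≢j i≡j
  ... | no _ = _

  𝟙 : Bool → ℕ
  𝟙 b = if b then 1 else 0

  𝟙-true : ∀ {b} → T b → 𝟙 b ≡ 1
  𝟙-true {true} _ = refl

  𝟙-false : ∀ {b} → ¬ T b → 𝟙 b ≡ 0
  𝟙-false {true} ¬b = ⊥-elim (¬b _)
  𝟙-false {false} _ = refl

  𝟙-∧ : ∀ a b → 𝟙 (a ∧ b) ≡ 𝟙 a * 𝟙 b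
  𝟙-∧ true b = sym (+-identityʳ (𝟙 b))
  𝟙-∧ false b = refl

  𝟙-split : ∀ a b → 𝟙 a ≡ 𝟙 (a ∧ b) + 𝟙 (a ∧ not b)
  𝟙-split true true = refl
  𝟙-split true false = refl
  𝟙-split false b = refl

  𝟙-exclusive-∨ : ∀ {a b c} → (T a → T b ⊎ T c) → (T b → T a) → (T c → T a) → (T b → ¬ T c) →
    𝟙 a ≡ 𝟙 b + 𝟙 c
  𝟙-exclusive-∨ {true} {true} {true} _ _ _ b⇒¬c = ⊥-elim (b⇒¬c _ _)
  𝟙-exclusive-∨ {true} {true} {false} _ _ _ _ = refl
  𝟙-exclusive-∨ {true} {false} {true} _ _ _ _ = refl
  𝟙-exclusive-∨ {true} {false} {false} a⇒b∨c _ _ _ with a⇒b∨c _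
  ... | inj₁ ()
  ... | inj₂ ()
  𝟙-exclusive-∨ {false} {true} _ b⇒a _ _ = ⊥-elim (b⇒a _)
  𝟙-exclusive-∨ {false} {false} {true} _ _ c⇒a _ = ⊥-elim (c⇒a _)
  𝟙-exclusive-∨ {false} {false} {false} _ _ _ _ = refl

  𝟙*≡𝟙 : ∀ b {x} → (T b → x ≡ 1) → 𝟙 b * x ≡ 𝟙 b
  𝟙*≡𝟙 true x≡1 = trans (+-identityʳ _) (x≡1 _)
  𝟙*≡𝟙 false _ = refl

  sum-allFin : ∀ n (f : Fin n → ℕ) → List.sum (map f (allFin n)) ≡ ∑[ i < n ] f i
  sum-allFin n f = trans (cong List.sum (map-tabulate id f)) (sum-tabulate n f)
    where
    sum-tabulate : ∀ n (f : Fin n → ℕ) → List.sum (tabulate f) ≡ ∑[ i < n ] f i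
    sum-tabulate zero f = refl
    sum-tabulate (suc n) f = cong (f zero +_) (sum-tabulate n (f ∘ suc))

  ∑-mono-≤ : ∀ {n} {f g : Fin n → ℕ} → (∀ i → f i ≤ g i) → ∑[ i < n ] f i ≤ ∑[ i < n ] g i
  ∑-mono-≤ {zero} f≤g = z≤n
  ∑-mono-≤ {suc n} f≤g = +-mono-≤ (f≤g zero) (∑-mono-≤ (f≤g ∘ suc))

  *-distribˡ-∑ : ∀ {n} c (f : Fin n → ℕ) → c * ∑[ i < n ] f i ≡ ∑[ i < n ] (c * f i)
  *-distribˡ-∑ {zero} c f = *-zeroʳ c
  *-distribˡ-∑ {suc n} c f =
    trans (*-distribˡ-+ c (f zero) _) (cong (c * f zero +_) (*-distribˡ-∑ c (f ∘ suc)))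

  ∑-zero : ∀ {n} {f : Fin n → ℕ} → (∀ i → f i ≡ 0) → ∑[ i < n ] f i ≡ 0
  ∑-zero {n} f≡0 = trans (sum-cong-≗ f≡0) (sum-replicate-zero n)

  ∑-one : ∀ n → ∑[ i < n ] 1 ≡ n
  ∑-one zero = refl
  ∑-one (suc n) = cong suc (∑-one n)

  ∑-select : ∀ {n} (x : Fin n) (f : Fin n → ℕ) → ∑[ i < n ] (𝟙 (i == x) * f i) ≡ f x
  ∑-select {suc n} zero f =
    trans (cong₂ _+_ (+-identityʳ (f zero)) (∑-zero {n} (λ _ → refl))) (+-identityʳ (f zero))
  ∑-select {suc n} (suc x) f = ∑-select x (f ∘ suc)

  count : ∀ {n} → (Fin n → Bool) → ℕ
  count {n} P = ∑[ i < n ] 𝟙 (P i)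

  count-== : ∀ {n} (x : Fin n) → count (_== x) ≡ 1
  count-== x = trans (sum-cong-≗ (λ u → sym (*-identityʳ (𝟙 (u == x))))) (∑-select x (λ _ → 1))

  count-none : ∀ {n} (P : Fin n → Bool) → (∀ i → ¬ T (P i)) → count P ≡ 0
  count-none P ¬P = ∑-zero (λ i → 𝟙-false (¬P i))

  count-mono : ∀ {n} {P Q : Fin n → Bool} → (∀ i → T (P i) → T (Q i)) → count P ≤ count Q
  count-mono {P = P} {Q} P⇒Q = ∑-mono-≤ 𝟙-mono
    where
    𝟙-mono : ∀ i → 𝟙 (P i) ≤ 𝟙 (Q i)
    𝟙-mono i with T? (P i)
    ... | yes Pi = ≤-reflexive (trans (𝟙-true Pi) (sym (𝟙-true (P⇒Q i Pi))))
    ... | no ¬Pi = ≤-trans (≤-reflexive (𝟙-false ¬Pi)) z≤n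

  count≤1 : ∀ {n} (P : Fin n → Bool) → (∀ i j → T (P i) → T (P j) → i ≡ j) → count P ≤ 1
  count≤1 {zero} P unique = z≤n
  count≤1 {suc n} P unique with T? (P zero)
  ... | yes P0 = ≤-reflexive (cong₂ _+_ (𝟙-true P0) (count-none (P ∘ suc) λ i Pi → 0≢suc (unique zero (suc i) P0 Pi)))
    where
    0≢suc : ∀ {i : Fin n} → zero ≢ suc i
    0≢suc ()
  ... | no ¬P0 = ≤-trans (≤-reflexive (cong (_+ count (P ∘ suc)) (𝟙-false ¬P0)))
                         (count≤1 (P ∘ suc) λ i j Pi Pj → suc-injective (unique (suc i) (suc j) Pi Pj))

  count≥1 : ∀ {n} (P : Fin n → Bool) i → T (P i) → 1 ≤ count P
  count≥1 P zero Pi = ≤-trans (≤-reflexive (sym (𝟙-true Pi))) (m≤m+n _ _)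
  count≥1 P (suc i) Pi = ≤-trans (count≥1 (P ∘ suc) i Pi) (m≤n+m _ _)

  count≥2 : ∀ {n} (P : Fin n → Bool) i j → T (P i) → T (P j) → i ≢ j → 2 ≤ count P
  count≥2 P zero zero Pi Pj i≢j = ⊥-elim (i≢j refl)
  count≥2 P zero (suc j) Pi Pj i≢j = +-mono-≤ (≤-reflexive (sym (𝟙-true Pi))) (count≥1 (P ∘ suc) j Pj)
  count≥2 P (suc i) zero Pi Pj i≢j = +-mono-≤ (≤-reflexive (sym (𝟙-true Pj))) (count≥1 (P ∘ suc) i Pi)
  count≥2 P (suc i) (suc j) Pi Pj i≢j = ≤-trans (count≥2 (P ∘ suc) i j Pi Pj (i≢j ∘ cong suc)) (m≤n+m _ _)

  count-split : ∀ {n} (P Q : Fin n → Bool) → count P ≡ count (λ u → P u ∧ Q u) + count (λ u → P u ∧ not (Q u))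
  count-split P Q = trans (sum-cong-≗ (λ u → 𝟙-split (P u) (Q u)))
                          (∑-distrib-+ (λ u → 𝟙 (P u ∧ Q u)) (λ u → 𝟙 (P u ∧ not (Q u))))

  length-filter : ∀ {n} (P : Fin n → Bool) → length (filter (T? ∘ P) (allFin n)) ≡ count P
  length-filter {n} P = trans (length-filter-sum (allFin n)) (sum-allFin n (𝟙 ∘ P))
    where
    length-filter-sum : ∀ xs → length (filter (T? ∘ P) xs) ≡ List.sum (map (𝟙 ∘ P) xs)
    length-filter-sum [] = refl
    length-filter-sum (x ∷ xs) with P x
    ... | true = cong suc (length-filter-sum xs)
    ... | false = length-filter-sum xs

  inFibre : ∀ {n m} → (Fin n → Fin m) → (Fin n → Bool) → Fin m → Fin n → Bool
  inFibre g P w u = (w == g u) ∧ P u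

  inFibre⁻ : ∀ {n m} (g : Fin n → Fin m) (P : Fin n → Bool) w u → T (inFibre g P w u) → g u ≡ w × T (P u)
  inFibre⁻ g P w u inF = let (w≡gu , Pu) = T-∧⁻ (w == g u) inF in sym (==⇒≡ w≡gu) , Pu

  count-fibres : ∀ {n m} (g : Fin n → Fin m) (P : Fin n → Bool) → count P ≡ ∑[ w < m ] count (inFibre g P w)
  count-fibres {n} {m} g P = begin
    ∑[ u < n ] 𝟙 (P u)                                 ≡⟨ sum-cong-≗ (λ u → ∑-select (g u) (λ _ → 𝟙 (P u))) ⟨
    ∑[ u < n ] ∑[ w < m ] (𝟙 (w == g u) * 𝟙 (P u))      ≡⟨ ∑-comm (λ u w → 𝟙 (w == g u) * 𝟙 (P u)) ⟩
    ∑[ w < m ] ∑[ u < n ] (𝟙 (w == g u) * 𝟙 (P u))      ≡⟨ sum-cong-≗ (λ w → sum-cong-≗ (λ u → 𝟙-∧ (w == g u) (P u))) ⟨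
    ∑[ w < m ] count (inFibre g P w)                   ∎
    where open ≡-Reasoning

  count-∘-fibres : ∀ {n m} (g : Fin n → Fin m) (P : Fin n → Bool) (Q : Fin m → Bool) →
    count (λ u → P u ∧ Q (g u)) ≡ ∑[ w < m ] (𝟙 (Q w) * count (inFibre g P w))
  count-∘-fibres g P Q = trans (count-fibres g (λ u → P u ∧ Q (g u))) (sum-cong-≗ fibre)
    where
    pointwise : ∀ w u → 𝟙 (inFibre g (λ u → P u ∧ Q (g u)) w u) ≡ 𝟙 (Q w) * 𝟙 (inFibre g P w u)
    pointwise w u with w ≟ g u
    ... | yes refl = trans (𝟙-∧ (P u) (Q (g u))) (*-comm (𝟙 (P u)) (𝟙 (Q (g u))))
    ... | no _ = sym (*-zeroʳ (𝟙 (Q w)))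
    fibre : ∀ w → count (inFibre g (λ u → P u ∧ Q (g u)) w) ≡ 𝟙 (Q w) * count (inFibre g P w)
    fibre w = trans (sum-cong-≗ (pointwise w)) (sym (*-distribˡ-∑ (𝟙 (Q w)) (𝟙 ∘ inFibre g P w)))

  count≤-injective : ∀ {n c} (P : Fin n → Bool) (ι : Fin n → Fin c) →
    (∀ u u' → T (P u) → T (P u') → ι u ≡ ι u' → u ≡ u') → count P ≤ c
  count≤-injective {n} {c} P ι injective = begin
    count P                              ≡⟨ count-fibres ι P ⟩
    ∑[ w < c ] count (inFibre ι P w)     ≤⟨ ∑-mono-≤ fibre≤1 ⟩
    ∑[ w < c ] 1                         ≡⟨ ∑-one c ⟩
    c                                    ∎
    where
    open ≤-Reasoning
    fibre≤1 : ∀ w → count (inFibre ι P w) ≤ 1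
    fibre≤1 w = count≤1 _ λ u u' inF inF' →
      let (ιu≡w , Pu) = inFibre⁻ ι P w u inF ; (ιu'≡w , Pu') = inFibre⁻ ι P w u' inF' in
      injective u u' Pu Pu' (trans ιu≡w (sym ιu'≡w))

  count≤c*count : ∀ {n m c} (P : Fin n → Bool) (Q : Fin m → Bool) (g : Fin n → Fin m) (ι : Fin n → Fin c) →
    (∀ u → T (P u) → T (Q (g u))) → (∀ u u' → T (P u) → T (P u') → g u ≡ g u' → ι u ≡ ι u' → u ≡ u') →
    count P ≤ c * count Q
  count≤c*count {n} {m} {c} P Q g ι P⇒Q∘g injective = begin
    count P                              ≡⟨ count-fibres g P ⟩
    ∑[ w < m ] count (inFibre g P w)     ≤⟨ ∑-mono-≤ fibre≤c ⟩
    ∑[ w < m ] (c * 𝟙 (Q w))             ≡⟨ *-distribˡ-∑ c (𝟙 ∘ Q) ⟨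
    c * count Q                          ∎
    where
    open ≤-Reasoning
    fibre≤c : ∀ w → count (inFibre g P w) ≤ c * 𝟙 (Q w)
    fibre≤c w with T? (Q w)
    ... | yes Qw = ≤-trans
      (count≤-injective _ ι λ u u' inF inF' →
        let (gu≡w , Pu) = inFibre⁻ g P w u inF ; (gu'≡w , Pu') = inFibre⁻ g P w u' inF' in
        injective u u' Pu Pu' (trans gu≡w (sym gu'≡w)))
      (≤-reflexive (trans (sym (*-identityʳ c)) (cong (c *_) (sym (𝟙-true Qw)))))
    ... | no ¬Qw = ≤-trans
      (≤-reflexive (count-none _ λ u inF →
        let (gu≡w , Pu) = inFibre⁻ g P w u inF in ¬Qw (subst (T ∘ Q) gu≡w (P⇒Q∘g u Pu))))
      z≤n

  count≤count-injective : ∀ {n m} (P : Fin n → Bool) (Q : Fin m → Bool) (g : Fin n → Fin m) →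
    (∀ u → T (P u) → T (Q (g u))) → (∀ u u' → T (P u) → T (P u') → g u ≡ g u' → u ≡ u') →
    count P ≤ count Q
  count≤count-injective P Q g P⇒Q∘g injective = ≤-trans
    (count≤c*count {c = 1} P Q g (λ _ → zero) P⇒Q∘g (λ u u' Pu Pu' gu≡gu' _ → injective u u' Pu Pu' gu≡gu'))
    (≤-reflexive (*-identityˡ _))

module Arithmetic where
  open import Data.Nat
  open import Data.Nat.Properties
  open import Data.Empty using (⊥)
  open import Relation.Binary.PropositionalEquality
  open import Data.Nat.Tactic.RingSolver using (solve-∀)
  open import Data.Fin.Properties using (fromℕ<-injective)
  open import Data.Nat.DivMod using (_mod_; _%_; m%n<n; m<n⇒m%n≡m; [m+kn]%n≡m%n; m*n%n≡0)
  open import Data.Nat.Induction using (<-rec)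
  open import Data.Product using (Σ; _×_; _,_)
  open import Relation.Nullary using (¬_; yes; no)
  open import Relation.Unary using (Decidable)

  least-witness : {P : ℕ → Set} → Decidable P → ∀ b → P b →
    Σ ℕ λ m → m ≤ b × P m × (∀ j → j < m → ¬ P j)
  least-witness {P} P? = <-rec _ search
    where
    search : ∀ b → (∀ {m} → m < b → P m → Σ ℕ λ m' → m' ≤ m × P m' × (∀ j → j < m' → ¬ P j)) →
      P b → Σ ℕ λ m → m ≤ b × P m × (∀ j → j < m → ¬ P j)
    search b below Pb with anyUpTo? P? b
    ... | no none = b , ≤-refl , Pb , λ j j<b Pj → none (j , j<b , Pj)
    ... | yes (m , m<b , Pm) with below m<b Pm
    ...   | m' , m'≤m , Pm' , first = m' , ≤-trans m'≤m (<⇒≤ m<b) , Pm' , first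

  mod-injective : ∀ {x y n} .{{_ : NonZero n}} → x mod n ≡ y mod n → x % n ≡ y % n
  mod-injective {x} {y} {n} = fromℕ<-injective (x % n) (y % n) (m%n<n x n) (m%n<n y n)

  mod-injective-below : ∀ {x y n} .{{_ : NonZero n}} → x < n → y < n → x mod n ≡ y mod n → x ≡ y
  mod-injective-below {x} {y} {n} x<n y<n eq = begin
    x        ≡⟨ m<n⇒m%n≡m x<n ⟨
    x % n    ≡⟨ mod-injective eq ⟩
    y % n    ≡⟨ m<n⇒m%n≡m y<n ⟩
    y        ∎
    where open ≡-Reasoning

  offset-unique-mod : ∀ {M} .{{_ : NonZero M}} c x {i i'} q q' → i ≤ i' → i' < M →
    x + i ≡ c + q * M → x + i' ≡ c + q' * M → i ≡ i'
  offset-unique-mod {M} c x {i} {i'} q q' i≤i' i'<M eq eq' = sym (begin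
    i'             ≡⟨ m+[n∸m]≡n i≤i' ⟨
    i + d          ≡⟨ cong (i +_) d≡0 ⟩
    i + 0          ≡⟨ +-identityʳ i ⟩
    i              ∎)
    where
    open ≡-Reasoning
    d = i' ∸ i
    q'M≡qM+d : q' * M ≡ d + q * M
    q'M≡qM+d = +-cancelˡ-≡ c _ _ (begin
      c + q' * M        ≡⟨ eq' ⟨
      x + i'            ≡⟨ cong (x +_) (m+[n∸m]≡n i≤i') ⟨
      x + (i + d)       ≡⟨ +-assoc x i d ⟨
      x + i + d         ≡⟨ cong (_+ d) eq ⟩
      c + q * M + d     ≡⟨ +-assoc c (q * M) d ⟩
      c + (q * M + d)   ≡⟨ cong (c +_) (+-comm (q * M) d) ⟩
      c + (d + q * M)   ∎)
    d≡0 : d ≡ 0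
    d≡0 = begin
      d                  ≡⟨ m<n⇒m%n≡m (≤-<-trans (m∸n≤m i' i) i'<M) ⟨
      d % M              ≡⟨ [m+kn]%n≡m%n d q M ⟨
      (d + q * M) % M    ≡⟨ cong (_% M) q'M≡qM+d ⟨
      (q' * M) % M       ≡⟨ m*n%n≡0 q' M ⟩
      0                  ∎

  1≤d⇒4d≤k⇒1≤k : ∀ {d k} → 1 ≤ d → 4 * d ≤ k → 1 ≤ k
  1≤d⇒4d≤k⇒1≤k {d} 1≤d 4d≤k = ≤-trans (≤-trans 1≤d (m≤n*m d 4)) 4d≤k

  counting-contradiction : ∀ {N k d L q s t} → 1 ≤ d → 60 * k ≤ N → 4 * d ≤ k → 5 * d * L ≤ N → 2 + t ≡ 2 * d →
    N ≤ suc (2 * L + t * (2 * L) + suc k * (2 * q + s)) → 40 * k * q < N → 40 * k * s < N → ⊥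
  counting-contradiction {N} {k} {d} {L} {q} {s} {t} 1≤d 60k≤N 4d≤k 5dL≤N t+2≡2d N≤ 40kq<N 40ks<N =
    <-irrefl refl (≤-trans lower upper)
    where
    1≤k = 1≤d⇒4d≤k⇒1≤k 1≤d 4d≤k
    A = 2 * L + t * (2 * L)
    X = 2 * q + s
    leaf-part : 5 * A ≤ 4 * N
    leaf-part = begin
      5 * A                   ≤⟨ *-monoʳ-≤ 5 (*-monoˡ-≤ (2 * L) (n≤1+n (suc t))) ⟩
      5 * ((2 + t) * (2 * L)) ≡⟨ cong (λ x → 5 * (x * (2 * L))) t+2≡2d ⟩
      5 * (2 * d * (2 * L))   ≡⟨ regroup d L ⟩
      4 * (5 * d * L)         ≤⟨ *-monoʳ-≤ 4 5dL≤N ⟩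
      4 * N                   ∎
      where
      open ≤-Reasoning
      regroup : ∀ d L → 5 * (2 * d * (2 * L)) ≡ 4 * (5 * d * L)
      regroup = solve-∀
    path-part : 40 * k * X ≤ 3 * N
    path-part = begin
      40 * k * (2 * q + s)           ≡⟨ distribute k q s ⟩
      2 * (40 * k * q) + 40 * k * s  ≤⟨ +-mono-≤ (*-monoʳ-≤ 2 (<⇒≤ 40kq<N)) (<⇒≤ 40ks<N) ⟩
      2 * N + N                      ≡⟨ +-comm (2 * N) N ⟩
      3 * N                          ∎
      where
      open ≤-Reasoning
      distribute : ∀ k q s → 40 * k * (2 * q + s) ≡ 2 * (40 * k * q) + 40 * k * s
      distribute = solve-∀
    upper : 5 * k * N ≤ 40 * k + 3 * N
    upper = +-cancelʳ-≤ (35 * k * N) _ _ (begin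
      5 * k * N + 35 * k * N                        ≡⟨ collect k N ⟩
      40 * k * N                                    ≤⟨ *-monoʳ-≤ (40 * k) N≤ ⟩
      40 * k * suc (A + suc k * X)                  ≡⟨ expand k A X ⟩
      40 * k + 8 * k * (5 * A) + suc k * (40 * k * X)
        ≤⟨ +-mono-≤ (+-monoʳ-≤ (40 * k) (*-monoʳ-≤ (8 * k) leaf-part)) (*-monoʳ-≤ (suc k) path-part) ⟩
      40 * k + 8 * k * (4 * N) + suc k * (3 * N)    ≡⟨ simplify k N ⟩
      40 * k + 3 * N + 35 * k * N                   ∎)
      where
      open ≤-Reasoning
      collect : ∀ k N → 5 * k * N + 35 * k * N ≡ 40 * k * N
      collect = solve-∀
      expand : ∀ k A X → 40 * k * suc (A + suc k * X) ≡ 40 * k + 8 * k * (5 * A) + suc k * (40 * k * X)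
      expand = solve-∀
      simplify : ∀ k N → 40 * k + 8 * k * (4 * N) + suc k * (3 * N) ≡ 40 * k + 3 * N + 35 * k * N
      simplify = solve-∀
    lower : suc (40 * k + 3 * N) ≤ 5 * k * N
    lower = begin
      suc (40 * k + 3 * N)     ≤⟨ +-mono-≤ 40k<2kN (*-monoʳ-≤ 3 (m≤m*n N k ⦃ >-nonZero 1≤k ⦄)) ⟩
      2 * k * N + 3 * (N * k)  ≡⟨ collect k N ⟩
      5 * k * N                ∎
      where
      open ≤-Reasoning
      21≤N : 21 ≤ N
      21≤N = ≤-trans (≤-trans (m≤m+n 21 39) (*-monoʳ-≤ 60 1≤k)) 60k≤N
      40k<2kN : suc (40 * k) ≤ 2 * k * N
      40k<2kN = begin
        suc (40 * k)    ≤⟨ m<n+m (40 * k) (≤-trans 1≤k (m≤n*m k 2)) ⟩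
        2 * k + 40 * k  ≡⟨ regroup k ⟩
        2 * k * 21      ≤⟨ *-monoʳ-≤ (2 * k) 21≤N ⟩
        2 * k * N       ∎
        where
        regroup : ∀ k → 2 * k + 40 * k ≡ 2 * k * 21
        regroup = solve-∀
      collect : ∀ k N → 2 * k * N + 3 * (N * k) ≡ 5 * k * N
      collect = solve-∀

module Lists where
  open import Data.Nat using (ℕ; zero; suc)
  open import Data.List using (List; []; _∷_; _++_; applyUpTo; applyDownFrom; last)
  open import Data.List.Relation.Unary.All using (All; []; _∷_)
  open import Data.List.Relation.Unary.AllPairs using (AllPairs; []; _∷_)
  open import Data.Maybe using (just)
  open import Function using (_∘_)
  open import Relation.Binary.PropositionalEquality using (_≡_; refl)

  allPairs-restrict : ∀ {A : Set} {P : A → Set} {R S : A → A → Set} {xs} → All P xs → AllPairs R xs →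
    (∀ {x y} → P x → P y → R x y → S x y) → AllPairs S xs
  allPairs-restrict [] [] _ = []
  allPairs-restrict {P = P} {R} {S} {x ∷ _} (px ∷ pxs) (rx ∷ rxs) R⇒S =
    restrict-head pxs rx ∷ allPairs-restrict pxs rxs R⇒S
    where
    restrict-head : ∀ {ys} → All P ys → All (R x) ys → All (S x) ys
    restrict-head [] [] = []
    restrict-head (py ∷ pys) (r ∷ rs) = R⇒S px py r ∷ restrict-head pys rs

  last-applyUpTo : ∀ {A : Set} (f : ℕ → A) n → last (applyUpTo f (suc n)) ≡ just (f n)
  last-applyUpTo f zero = refl
  last-applyUpTo f (suc n) = last-applyUpTo (f ∘ suc) n

  last-applyDownFrom : ∀ {A : Set} (f : ℕ → A) n → last (applyDownFrom f (suc n)) ≡ just (f 0)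
  last-applyDownFrom f zero = refl
  last-applyDownFrom f (suc n) = last-applyDownFrom f n

  last-++-∷ : ∀ {A : Set} (xs : List A) y ys → last (xs ++ y ∷ ys) ≡ last (y ∷ ys)
  last-++-∷ [] y ys = refl
  last-++-∷ (x ∷ []) y ys = refl
  last-++-∷ (x ∷ x' ∷ xs) y ys = last-++-∷ (x' ∷ xs) y ys

module Trees where
  open import Defs
  open Counting
  open Arithmetic
  open Lists
  open import Data.Nat hiding (_≟_)
  open import Data.Nat.Properties hiding (_≟_)
  open import Data.Nat.Induction using (<-rec)
  open import Data.Nat.DivMod using (_mod_; _%_; _/_; m%n≤m; m≡m%n+[m/n]*n; m*n%n≡0)
  open import Data.Nat.Tactic.RingSolver using (solve-∀)
  open import Data.Bool using (Bool; true; false; T; not; _∧_; if_then_else_)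
  open import Data.Bool.Properties using (T?)
  open import Data.Fin using (Fin; zero; suc; _≟_)
  open import Data.Fin.Properties using (any?)
  open import Data.Empty using (⊥; ⊥-elim)
  open import Data.Product using (Σ; ∃; _×_; _,_; proj₁; proj₂)
  open import Data.Sum using (_⊎_; inj₁; inj₂)
  open import Data.Maybe using (just; nothing)
  open import Data.Maybe.Properties using (just-injective)
  open import Data.Maybe.Relation.Binary.Connected using (Connected; just; just-nothing)
  open import Data.List using (List; _++_; applyUpTo; applyDownFrom; last; head; length; map; filter; allFin; concat)
  open import Data.List.Properties using (length-++; length-applyUpTo; length-applyDownFrom; ++-identityʳ; length-map)
  open import Data.List.Membership.Propositional using (_∈_)
  open import Data.List.Membership.Propositional.Properties using (∈-applyUpTo⁻; ∈-applyDownFrom⁻; ∈-filter⁻)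
  open import Data.List.Relation.Binary.Disjoint.Propositional using (Disjoint)
  open import Data.List.Relation.Unary.All using (All)
  import Data.List.Relation.Unary.All as All
  import Data.List.Relation.Unary.All.Properties as Allₚ
  import Data.List.Relation.Unary.AllPairs.Properties as AllPairsₚ
  open import Data.List.Relation.Unary.Linked using (Linked)
  import Data.List.Relation.Unary.Linked.Properties as Linkedₚ
  open import Data.List.Relation.Unary.Unique.Propositional using (Unique)
  import Data.List.Relation.Unary.Unique.Propositional.Properties as Uniqueₚ
  open import Function using (_∘_)
  open import Relation.Nullary using (¬_; Dec; yes; no; ¬?; does)
  open import Relation.Nullary.Decidable using (_×-dec_; decidable-stable)
  open import Relation.Binary.PropositionalEquality

  walk? : ∀ {N} (G : Graph N) u w l → Dec (Walk G u w l)
  walk? G u w zero with u ≟ w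
  ... | yes refl = yes here
  ... | no u≢w = no λ { here → u≢w refl }
  walk? G u w (suc l) with any? (λ x → T? (G u x) ×-dec walk? G x w l)
  ... | yes (x , ux , xw) = yes (step ux xw)
  ... | no none = no λ { (step ux xw) → none (_ , ux , xw) }

  module RootedTree {N : ℕ} (G : Graph N) (tree : IsTree G) (r : Fin N) where

    adj-sym : ∀ {u v} → Adj G u v → Adj G v u
    adj-sym {u} {v} = subst T (proj₁ tree u v)

    adj⇒≢ : ∀ {u v} → Adj G u v → u ≢ v
    adj⇒≢ {u} loop refl = subst T (proj₁ (proj₂ tree) u) loop

    acyclic : ∀ xs → ¬ IsCycle G xs
    acyclic = proj₂ (proj₂ (proj₂ tree))

    walk-snoc : ∀ {u v w l} → Walk G u v l → Adj G v w → Walk G u w (suc l)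
    walk-snoc here vw = step vw here
    walk-snoc (step uu' u'v) vw = step uu' (walk-snoc u'v vw)

    walk-reverse : ∀ {u v l} → Walk G u v l → Walk G v u l
    walk-reverse here = here
    walk-reverse (step uu' u'v) = walk-snoc (walk-reverse u'v) (adj-sym uu')

    abstract
      shortestToRoot : ∀ v → Σ ℕ λ m → Walk G v r m × (∀ l → Walk G v r l → m ≤ l)
      shortestToRoot v with least-witness (walk? G v r) _ (proj₂ (proj₁ (proj₂ (proj₂ tree)) v r))
      ... | m , _ , walk , first = m , walk , λ l w → ≮⇒≥ (λ l<m → first l l<m w)

    depth : Fin N → ℕ
    depth v = proj₁ (shortestToRoot v)

    toRoot : ∀ v → Walk G v r (depth v)
    toRoot v = proj₁ (proj₂ (shortestToRoot v))

    depth-minimal : ∀ {v l} → Walk G v r l → depth v ≤ l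
    depth-minimal {v} = proj₂ (proj₂ (shortestToRoot v)) _

    firstStep : ∀ {v l} → Walk G v r l → Fin N
    firstStep here = r
    firstStep (step {v = w} _ _) = w

    parent : Fin N → Fin N
    parent v = firstStep (toRoot v)

    firstStep-cases : ∀ {v l} (walk : Walk G v r l) →
      (v ≡ r × l ≡ 0 × firstStep walk ≡ r)
      ⊎ (Σ ℕ λ l' → l ≡ suc l' × Adj G v (firstStep walk) × Walk G (firstStep walk) r l')
    firstStep-cases here = inj₁ (refl , refl , refl)
    firstStep-cases (step vw rest) = inj₂ (_ , refl , vw , rest)

    depth-root : depth r ≡ 0
    depth-root = n≤0⇒n≡0 (depth-minimal here)

    depth≡0⇒root : ∀ {v} → depth v ≡ 0 → v ≡ r
    depth≡0⇒root {v} d≡0 with firstStep-cases (toRoot v)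
    ... | inj₁ (v≡r , _ , _) = v≡r
    ... | inj₂ (_ , d≡suc , _ , _) = ⊥-elim (0≢1+n (trans (sym d≡0) d≡suc))

    parent-root : parent r ≡ r
    parent-root with firstStep-cases (toRoot r)
    ... | inj₁ (_ , _ , p≡r) = p≡r
    ... | inj₂ (_ , d≡suc , _ , _) = ⊥-elim (0≢1+n (trans (sym depth-root) d≡suc))

    adj-parent : ∀ {v} → v ≢ r → Adj G v (parent v)
    adj-parent {v} v≢r with firstStep-cases (toRoot v)
    ... | inj₁ (v≡r , _ , _) = ⊥-elim (v≢r v≡r)
    ... | inj₂ (_ , _ , vp , _) = vp

    depth-parent : ∀ {v} → v ≢ r → suc (depth (parent v)) ≡ depth v
    depth-parent {v} v≢r with firstStep-cases (toRoot v)
    ... | inj₁ (v≡r , _ , _) = ⊥-elim (v≢r v≡r)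
    ... | inj₂ (l , d≡suc , vp , rest) =
      ≤-antisym (≤-trans (s≤s (depth-minimal rest)) (≤-reflexive (sym d≡suc)))
                (depth-minimal (step vp (toRoot (parent v))))

    depth-parent< : ∀ {v} → v ≢ r → depth (parent v) < depth v
    depth-parent< v≢r = ≤-reflexive (depth-parent v≢r)

    depth-parent∸1 : ∀ v → depth (parent v) ≡ depth v ∸ 1
    depth-parent∸1 v with v ≟ r
    ... | yes v≡r = subst (λ x → depth (parent x) ≡ depth x ∸ 1) (sym v≡r)
      (trans (cong depth parent-root) (trans depth-root (cong (_∸ 1) (sym depth-root))))
    ... | no v≢r = cong (_∸ 1) (depth-parent v≢r)

    ancestor : ℕ → Fin N → Fin N
    ancestor zero v = v
    ancestor (suc j) v = ancestor j (parent v)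

    ancestor-suc : ∀ j v → ancestor (suc j) v ≡ parent (ancestor j v)
    ancestor-suc zero v = refl
    ancestor-suc (suc j) v = ancestor-suc j (parent v)

    ancestor-root : ∀ j → ancestor j r ≡ r
    ancestor-root zero = refl
    ancestor-root (suc j) = trans (cong (ancestor j) parent-root) (ancestor-root j)

    depth-ancestor : ∀ j v → depth (ancestor j v) ≡ depth v ∸ j
    depth-ancestor zero v = refl
    depth-ancestor (suc j) v =
      trans (depth-ancestor j (parent v)) (trans (cong (_∸ j) (depth-parent∸1 v)) (∸-+-assoc (depth v) 1 j))

    ancestor-depth : ∀ v → ancestor (depth v) v ≡ r
    ancestor-depth v = depth≡0⇒root (trans (depth-ancestor (depth v) v) (n∸n≡0 (depth v)))

    ancestor≢root : ∀ {j v} → j < depth v → ancestor j v ≢ r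
    ancestor≢root {j} {v} j<d ≡r = <-irrefl (trans (sym depth-root) (cong depth (sym ≡r)))
      (subst (0 <_) (sym (depth-ancestor j v)) (m<n⇒0<n∸m j<d))

    ancestor≢root⇒< : ∀ {j v} → ancestor j v ≢ r → j < depth v
    ancestor≢root⇒< {j} {v} ≢r with j <? depth v
    ... | yes j<d = j<d
    ... | no j≮d = ⊥-elim (≢r (depth≡0⇒root (trans (depth-ancestor j v) (m≤n⇒m∸n≡0 (≮⇒≥ j≮d)))))

    ancestor-injective : ∀ {i j v} → i < j → j ≤ depth v → ancestor i v ≢ ancestor j v
    ancestor-injective {i} {j} {v} i<j j≤d eq = <-irrefl (sym (cong depth eq))
      (subst₂ _<_ (sym (depth-ancestor j v)) (sym (depth-ancestor i v)) (∸-monoʳ-< i<j j≤d))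

    adj-ancestor : ∀ {j v} → j < depth v → Adj G (ancestor j v) (ancestor (suc j) v)
    adj-ancestor {j} {v} j<d = subst (Adj G _) (sym (ancestor-suc j v)) (adj-parent (ancestor≢root j<d))

    depth-induction : (P : Fin N → Set) → (∀ v → (∀ u → depth u < depth v → P u) → P v) → ∀ v → P v
    depth-induction P rec v = <-rec (λ d → ∀ v → depth v ≡ d → P v)
      (λ { d below v refl → rec v (λ u du<dv → below du<dv u refl) }) (depth v) v refl

    InSubtree : Fin N → Fin N → Set
    InSubtree y x = ∃ λ j → j < suc (depth x) × ancestor j x ≡ y

    inSubtree? : ∀ y x → Dec (InSubtree y x)
    inSubtree? y x = anyUpTo? (λ j → ancestor j x ≟ y) (suc (depth x))

    subtree-refl : ∀ x → InSubtree x x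
    subtree-refl x = 0 , z<s , refl

    subtree-of-root : ∀ {y} → InSubtree y r → y ≡ r
    subtree-of-root (j , _ , eq) = trans (sym eq) (ancestor-root j)

    subtree-child : ∀ {y x} → x ≢ r → InSubtree y (parent x) → InSubtree y x
    subtree-child x≢r (j , j<d , eq) =
      suc j , ≤-trans (s≤s j<d) (≤-reflexive (cong suc (depth-parent x≢r))) , eq

    subtree-parent : ∀ {y x} → InSubtree y x → y ≢ x → InSubtree y (parent x)
    subtree-parent (zero , _ , eq) y≢x = ⊥-elim (y≢x (sym eq))
    subtree-parent {x = x} (suc j , sj<d , eq) _ =
      j , s≤s (≤-trans (∸-monoˡ-≤ 1 (≤-pred sj<d)) (≤-reflexive (sym (depth-parent∸1 x)))) , eq

    subtree-antisym : ∀ {x y} → InSubtree y x → InSubtree x y → x ≡ y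
    subtree-antisym {x} {y} (zero , _ , eq) _ = eq
    subtree-antisym {x} {y} (suc j , sj<d , eq) (j' , _ , eq') = ⊥-elim (<-irrefl same-depth deeper)
      where
      depth-y : depth y ≡ depth x ∸ suc j
      depth-y = trans (cong depth (sym eq)) (depth-ancestor (suc j) x)
      same-depth : depth x ∸ suc j ≡ depth x
      same-depth = ≤-antisym (m∸n≤m _ (suc j))
        (≤-trans (≤-reflexive (trans (cong depth (sym eq')) (depth-ancestor j' y)))
                 (≤-trans (m∸n≤m _ j') (≤-reflexive depth-y)))
      deeper : depth x ∸ suc j < depth x
      deeper = ∸-monoʳ-< {depth x} {suc j} {0} z<s (≤-pred sj<d)

    module CycleThroughEdge {u v} (uv : Adj G u v) (pu≢v : parent u ≢ v) (pv≢u : parent v ≢ u) where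

      meet : Σ ℕ λ m → m ≤ depth u × InSubtree (ancestor m u) v × (∀ m' → m' < m → ¬ InSubtree (ancestor m' u) v)
      meet = least-witness (λ m → inSubtree? (ancestor m u) v)
               (depth u) (depth v , ≤-refl , trans (ancestor-depth v) (sym (ancestor-depth u)))

      i : ℕ
      i = proj₁ meet

      i≤depth : i ≤ depth u
      i≤depth = proj₁ (proj₂ meet)

      first : ∀ i' → i' < i → ¬ InSubtree (ancestor i' u) v
      first = proj₂ (proj₂ (proj₂ meet))

      j : ℕ
      j = proj₁ (proj₁ (proj₂ (proj₂ meet)))

      j≤depth : j ≤ depth v
      j≤depth = ≤-pred (proj₁ (proj₂ (proj₁ (proj₂ (proj₂ meet)))))

      meets : ancestor j v ≡ ancestor i u
      meets = proj₂ (proj₂ (proj₁ (proj₂ (proj₂ meet))))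

      above-u above-v : ℕ → Fin N
      above-u x = ancestor x u
      above-v x = ancestor x v

      up : List (Fin N)
      up = applyUpTo above-u (suc i)

      down : List (Fin N)
      down = applyDownFrom above-v j

      cycle : List (Fin N)
      cycle = up ++ down

      unique : Unique cycle
      unique = Uniqueₚ.++⁺
        (Uniqueₚ.applyUpTo⁺₁ above-u (suc i) λ x<y y<si →
          ancestor-injective x<y (≤-trans (≤-pred y<si) i≤depth))
        (Uniqueₚ.applyDownFrom⁺₁ above-v j λ y<x x<j eq →
          ancestor-injective y<x (≤-trans (<⇒≤ x<j) j≤depth) (sym eq))
        disjoint
        where
        disjoint : ∀ {x} → ¬ (x ∈ up × x ∈ down)
        disjoint (x∈up , x∈down) with ∈-applyUpTo⁻ above-u x∈up | ∈-applyDownFrom⁻ above-v x∈down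
        ... | a , a<si , refl | b , b<j , eq with m≤n⇒m<n∨m≡n (≤-pred a<si)
        ...   | inj₁ a<i = first a a<i (b , s≤s (≤-trans (<⇒≤ b<j) j≤depth) , sym eq)
        ...   | inj₂ refl = ancestor-injective b<j j≤depth (trans (sym eq) (sym meets))

      linked : Linked (Adj G) cycle
      linked = Linkedₚ.++⁺
        (Linkedₚ.applyUpTo⁺₁ above-u (suc i) λ {x} sx<si →
          adj-ancestor {x} {u} (<-≤-trans (≤-pred sx<si) i≤depth))
        junction
        (Linkedₚ.applyDownFrom⁺₁ above-v j λ {x} sx<j →
          adj-sym (adj-ancestor {x} {v} (<-≤-trans (<-trans (n<1+n x) sx<j) j≤depth)))
        where
        last-up : last up ≡ just (ancestor i u)
        last-up = last-applyUpTo above-u i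
        junction : Connected (Adj G) (last up) (head down)
        junction with j | meets | j≤depth
        ... | zero | _ | _ = subst (λ m → Connected (Adj G) m nothing) (sym last-up) just-nothing
        ... | suc j' | meets' | sj'≤d = subst (λ m → Connected (Adj G) m (just (ancestor j' v))) (sym last-up)
          (just (adj-sym (subst (Adj G (ancestor j' v)) (trans (sym (ancestor-suc j' v)) meets')
                                (adj-parent (ancestor≢root sj'≤d)))))

      last-cycle : last cycle ≡ just v
      last-cycle with j | meets
      ... | zero | meets' = trans (cong last (++-identityʳ up)) (trans (last-applyUpTo above-u i) (cong just (sym meets')))
      ... | suc j' | _ = trans (last-++-∷ up (ancestor j' v) (applyDownFrom above-v j')) (last-applyDownFrom above-v j')

      length-cycle : length (applyUpTo (above-u ∘ suc) i ++ down) ≡ i + j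
      length-cycle = trans (length-++ (applyUpTo (above-u ∘ suc) i))
                           (cong₂ _+_ (length-applyUpTo (above-u ∘ suc) i) (length-applyDownFrom above-v j))

      length≥3 : 2 ≤ i + j
      length≥3 with i | j | meets
      ... | zero | zero | meets' = ⊥-elim (adj⇒≢ uv (sym meets'))
      ... | zero | suc zero | meets' = ⊥-elim (pv≢u meets')
      ... | zero | suc (suc _) | _ = s≤s (s≤s z≤n)
      ... | suc zero | zero | meets' = ⊥-elim (pu≢v (sym meets'))
      ... | suc zero | suc _ | _ = s≤s (s≤s z≤n)
      ... | suc (suc _) | _ | _ = s≤s (s≤s z≤n)

      contradiction : ⊥
      contradiction = acyclic cycle
        ( (unique , linked)
        , ≤-trans length≥3 (≤-reflexive (sym length-cycle))
        , λ y last≡y → subst (λ z → Adj G z u) (just-injective (trans (sym last-cycle) last≡y)) (adj-sym uv))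

    parent-edge⇒≢root : ∀ {u v} → Adj G u v → parent u ≡ v → u ≢ r
    parent-edge⇒≢root uv pu≡v refl = adj⇒≢ uv (trans (sym parent-root) pu≡v)

    edge-to-parent : ∀ {u v} → Adj G u v → (u ≢ r × parent u ≡ v) ⊎ (v ≢ r × parent v ≡ u)
    edge-to-parent {u} {v} uv with parent u ≟ v | parent v ≟ u
    ... | yes pu≡v | _ = inj₁ (parent-edge⇒≢root uv pu≡v , pu≡v)
    ... | no _ | yes pv≡u = inj₂ (parent-edge⇒≢root (adj-sym uv) pv≡u , pv≡u)
    ... | no pu≢v | no pv≢u = ⊥-elim (CycleThroughEdge.contradiction uv pu≢v pv≢u)

    no-2-cycle : ∀ {u v} → u ≢ r → v ≢ r → parent u ≡ v → parent v ≡ u → ⊥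
    no-2-cycle {u} {v} u≢r v≢r pu≡v pv≡u =
      <-asym (subst (_< depth u) (cong depth pu≡v) (depth-parent< u≢r))
             (subst (_< depth v) (cong depth pv≡u) (depth-parent< v≢r))

    nonRoot : Fin N → Bool
    nonRoot u = not (u == r)

    isChild : Fin N → Fin N → Bool
    isChild = inFibre parent nonRoot

    children : Fin N → ℕ
    children w = count (isChild w)

    isParentOf : Fin N → Fin N → Bool
    isParentOf w v = (v == parent w) ∧ nonRoot w

    child⁻ : ∀ {w u} → T (isChild w u) → parent u ≡ w × u ≢ r
    child⁻ {w} {u} c = let (pu≡w , nr) = inFibre⁻ parent nonRoot w u c in pu≡w , not-==⇒≢ nr

    child⁺ : ∀ {w u} → parent u ≡ w → u ≢ r → T (isChild w u)
    child⁺ pu≡w u≢r = T-∧⁺ (≡⇒== (sym pu≡w)) (≢⇒not-== u≢r)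

    isParentOf⁻ : ∀ {w v} → T (isParentOf w v) → parent w ≡ v × w ≢ r
    isParentOf⁻ {w} {v} p = let (v≡pw , nr) = T-∧⁻ (v == parent w) p in sym (==⇒≡ v≡pw) , not-==⇒≢ nr

    isParentOf⁺ : ∀ {w v} → parent w ≡ v → w ≢ r → T (isParentOf w v)
    isParentOf⁺ pw≡v w≢r = T-∧⁺ (≡⇒== (sym pw≡v)) (≢⇒not-== w≢r)

    𝟙-adjacent : ∀ w v → 𝟙 (G w v) ≡ 𝟙 (isChild w v) + 𝟙 (isParentOf w v)
    𝟙-adjacent w v = 𝟙-exclusive-∨ edge-cases child⇒adj parent⇒adj child⇒¬parent
      where
      edge-cases : Adj G w v → T (isChild w v) ⊎ T (isParentOf w v)
      edge-cases wv with edge-to-parent wv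
      ... | inj₁ (w≢r , pw≡v) = inj₂ (isParentOf⁺ pw≡v w≢r)
      ... | inj₂ (v≢r , pv≡w) = inj₁ (child⁺ pv≡w v≢r)
      child⇒adj : T (isChild w v) → Adj G w v
      child⇒adj c = let (pv≡w , v≢r) = child⁻ {w} {v} c in adj-sym (subst (Adj G v) pv≡w (adj-parent v≢r))
      parent⇒adj : T (isParentOf w v) → Adj G w v
      parent⇒adj p = let (pw≡v , w≢r) = isParentOf⁻ {w} {v} p in subst (Adj G w) pw≡v (adj-parent w≢r)
      child⇒¬parent : T (isChild w v) → ¬ T (isParentOf w v)
      child⇒¬parent c p = let (pv≡w , v≢r) = child⁻ {w} {v} c ; (pw≡v , w≢r) = isParentOf⁻ {w} {v} p in
        no-2-cycle v≢r w≢r pv≡w pw≡v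

    degree≡children+nonRoot : ∀ w → degree G w ≡ children w + 𝟙 (nonRoot w)
    degree≡children+nonRoot w = begin
      degree G w                                           ≡⟨ sum-allFin N (𝟙 ∘ G w) ⟩
      ∑[ v < N ] 𝟙 (G w v)                                 ≡⟨ sum-cong-≗ (𝟙-adjacent w) ⟩
      ∑[ v < N ] (𝟙 (isChild w v) + 𝟙 (isParentOf w v))    ≡⟨ ∑-distrib-+ (𝟙 ∘ isChild w) (𝟙 ∘ isParentOf w) ⟩
      children w + ∑[ v < N ] 𝟙 (isParentOf w v)           ≡⟨ cong (children w +_) parents ⟩
      children w + 𝟙 (nonRoot w)                           ∎
      where
      open ≡-Reasoning
      parents : ∑[ v < N ] 𝟙 (isParentOf w v) ≡ 𝟙 (nonRoot w)
      parents = trans (sum-cong-≗ (λ v → 𝟙-∧ (v == parent w) (nonRoot w)))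
                      (∑-select (parent w) (λ _ → 𝟙 (nonRoot w)))

    degree-nonRoot : ∀ {u} → u ≢ r → degree G u ≡ suc (children u)
    degree-nonRoot {u} u≢r = begin
      degree G u                  ≡⟨ degree≡children+nonRoot u ⟩
      children u + 𝟙 (nonRoot u)  ≡⟨ cong (children u +_) (𝟙-true (≢⇒not-== u≢r)) ⟩
      children u + 1              ≡⟨ +-comm (children u) 1 ⟩
      suc (children u)            ∎
      where open ≡-Reasoning

    count-nonRoot : suc (count nonRoot) ≡ N
    count-nonRoot = begin
      suc (count nonRoot)                             ≡⟨ cong (_+ count nonRoot) (count-== r) ⟨
      count (λ u → true ∧ (u == r)) + count nonRoot   ≡⟨ count-split (λ _ → true) (_== r) ⟨
      count {N} (λ _ → true)                          ≡⟨ ∑-one N ⟩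
      N                                               ∎
      where open ≡-Reasoning

    ∑-children : ∑[ w < N ] children w ≡ count nonRoot
    ∑-children = sym (count-fibres parent nonRoot)

    leaf : Fin N → Bool
    leaf v = degree G v ≡ᵇ 1

    deg2 : Fin N → Bool
    deg2 v = nonRoot v ∧ (degree G v ≡ᵇ 2)

    branch : Fin N → Bool
    branch v = nonRoot v ∧ not (degree G v ≡ᵇ 2)

    count-nonRoot≡branch+deg2 : count nonRoot ≡ count branch + count deg2
    count-nonRoot≡branch+deg2 = trans (count-split nonRoot (λ v → degree G v ≡ᵇ 2)) (+-comm (count deg2) (count branch))

    count-branch≤2*count-leaf : count branch ≤ 2 * count leaf
    count-branch≤2*count-leaf = +-cancelʳ-≤ (count branch + count deg2) (count branch) (2 * count leaf) (begin
      count branch + (count branch + count deg2)            ≡⟨ regroup (count branch) (count deg2) ⟩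
      2 * count branch + count deg2                         ≡⟨ cong (_+ count deg2) (*-distribˡ-∑ 2 (𝟙 ∘ branch)) ⟩
      ∑[ w < N ] (2 * 𝟙 (branch w)) + count deg2            ≡⟨ ∑-distrib-+ (λ w → 2 * 𝟙 (branch w)) (𝟙 ∘ deg2) ⟨
      ∑[ w < N ] (2 * 𝟙 (branch w) + 𝟙 (deg2 w))           ≤⟨ ∑-mono-≤ weight≤ ⟩
      ∑[ w < N ] (children w + 2 * 𝟙 (leaf w))              ≡⟨ ∑-distrib-+ children (λ w → 2 * 𝟙 (leaf w)) ⟩
      ∑[ w < N ] children w + ∑[ w < N ] (2 * 𝟙 (leaf w))  ≡⟨ cong₂ _+_ (sym ∑-children) (*-distribˡ-∑ 2 (𝟙 ∘ leaf)) ⟨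
      count nonRoot + 2 * count leaf                        ≡⟨ cong (_+ 2 * count leaf) count-nonRoot≡branch+deg2 ⟩
      count branch + count deg2 + 2 * count leaf            ≡⟨ +-comm (count branch + count deg2) (2 * count leaf) ⟩
      2 * count leaf + (count branch + count deg2)          ∎)
      where
      open ≤-Reasoning
      regroup : ∀ b d → b + (b + d) ≡ 2 * b + d
      regroup = solve-∀
      nonRoot-weight≤ : ∀ {d c} → d ≡ suc c → 2 * 𝟙 (not (d ≡ᵇ 2)) + 𝟙 (d ≡ᵇ 2) ≤ c + 2 * 𝟙 (d ≡ᵇ 1)
      nonRoot-weight≤ {c = zero} refl = ≤-refl
      nonRoot-weight≤ {c = suc zero} refl = ≤-refl
      nonRoot-weight≤ {c = suc (suc c)} refl = s≤s (s≤s z≤n)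
      vertex-weight≤ : ∀ nr d c → d ≡ c + 𝟙 nr →
        2 * 𝟙 (nr ∧ not (d ≡ᵇ 2)) + 𝟙 (nr ∧ (d ≡ᵇ 2)) ≤ c + 2 * 𝟙 (d ≡ᵇ 1)
      vertex-weight≤ false d c _ = z≤n
      vertex-weight≤ true d c d≡c+1 = nonRoot-weight≤ (trans d≡c+1 (+-comm c 1))
      weight≤ : ∀ w → 2 * 𝟙 (branch w) + 𝟙 (deg2 w) ≤ children w + 2 * 𝟙 (leaf w)
      weight≤ w = vertex-weight≤ (nonRoot w) (degree G w) (children w) (degree≡children+nonRoot w)

    deg2⇒≢root : ∀ {v} → T (deg2 v) → v ≢ r
    deg2⇒≢root {v} d = not-==⇒≢ (proj₁ (T-∧⁻ (nonRoot v) d))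

    deg2⇒degree≡2 : ∀ {v} → T (deg2 v) → degree G v ≡ 2
    deg2⇒degree≡2 {v} d = ≡ᵇ⇒≡ (degree G v) 2 (proj₂ (T-∧⁻ (nonRoot v) d))

    deg2⁺ : ∀ {v} → v ≢ r → degree G v ≡ 2 → T (deg2 v)
    deg2⁺ {v} v≢r d≡2 = T-∧⁺ (≢⇒not-== v≢r) (≡⇒≡ᵇ (degree G v) 2 d≡2)

    deg2⇒children≡1 : ∀ {v} → T (deg2 v) → children v ≡ 1
    deg2⇒children≡1 d = suc-injective (trans (sym (degree-nonRoot (deg2⇒≢root d))) (deg2⇒degree≡2 d))

    deg2-parent⇒≢root : ∀ {v} → T (deg2 (parent v)) → v ≢ r
    deg2-parent⇒≢root d refl = deg2⇒≢root d parent-root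

    unique-child : ∀ {w x y} → T (deg2 w) → parent x ≡ w → parent y ≡ w → x ≢ r → y ≢ r → x ≡ y
    unique-child {w} {x} {y} d px≡w py≡w x≢r y≢r with x ≟ y
    ... | yes x≡y = x≡y
    ... | no x≢y = ⊥-elim (<-irrefl refl (begin
      2           ≤⟨ count≥2 (isChild w) x y (child⁺ px≡w x≢r) (child⁺ py≡w y≢r) x≢y ⟩
      children w  ≡⟨ deg2⇒children≡1 d ⟩
      1           ∎))
      where open ≤-Reasoning

    ancestor-cancel : ∀ j {x y} → ancestor j x ≡ ancestor j y →
      (∀ i → 0 < i → i ≤ j → T (deg2 (ancestor i x))) → x ≡ y
    ancestor-cancel zero eq _ = eq
    ancestor-cancel (suc j) {x} {y} eq deg2-above =
      ancestor-cancel j below-equal (λ i 0<i i≤j → deg2-above i 0<i (m≤n⇒m≤1+n i≤j))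
      where
      d : T (deg2 (parent (ancestor j x)))
      d = subst (T ∘ deg2) (ancestor-suc j x) (deg2-above (suc j) z<s ≤-refl)
      py≡px : parent (ancestor j y) ≡ parent (ancestor j x)
      py≡px = trans (sym (ancestor-suc j y)) (trans (sym eq) (ancestor-suc j x))
      below-equal : ancestor j x ≡ ancestor j y
      below-equal = unique-child d refl py≡px (deg2-parent⇒≢root d)
                                 (deg2-parent⇒≢root (subst (T ∘ deg2) (sym py≡px) d))

    leaf⇒degree≡1 : ∀ {v} → T (leaf v) → degree G v ≡ 1
    leaf⇒degree≡1 {v} = ≡ᵇ⇒≡ (degree G v) 1

    leaf⇒¬deg2 : ∀ {v} → T (leaf v) → ¬ T (deg2 v)
    leaf⇒¬deg2 l d with trans (sym (leaf⇒degree≡1 l)) (deg2⇒degree≡2 d)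
    ... | ()

    leaf-childless : ∀ {ℓ u} → T (leaf ℓ) → ℓ ≢ r → parent u ≡ ℓ → u ≢ r → ⊥
    leaf-childless {ℓ} {u} l ℓ≢r pu≡ℓ u≢r = <-irrefl refl (begin
      1           ≤⟨ count≥1 (isChild ℓ) u (child⁺ pu≡ℓ u≢r) ⟩
      children ℓ  ≡⟨ suc-injective (trans (sym (degree-nonRoot ℓ≢r)) (leaf⇒degree≡1 l)) ⟩
      0           ∎)
      where open ≤-Reasoning

    -- For a degree-2 vertex v, run v is its position, counted from the top, in the maximal upward
    -- chain v, parent v, … of degree-2 vertices.
    runFrom : ℕ → Fin N → ℕ
    runFrom zero v = 1
    runFrom (suc m) v = if deg2 (parent v) then suc (runFrom m (parent v)) else 1

    run : Fin N → ℕ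
    run v = runFrom (depth v) v

    run-parent : ∀ {v} → T (deg2 (parent v)) → run v ≡ suc (run (parent v))
    run-parent {v} d =
      trans (cong (λ m → runFrom m v) (sym (depth-parent (deg2-parent⇒≢root d)))) (if-true d)

    run-top : ∀ {v} → ¬ T (deg2 (parent v)) → run v ≡ 1
    run-top {v} ¬d = runFrom-top (depth v)
      where
      runFrom-top : ∀ m → runFrom m v ≡ 1
      runFrom-top zero = refl
      runFrom-top (suc m) = if-false ¬d

    run≥1 : ∀ v → 1 ≤ run v
    run≥1 v with T? (deg2 (parent v))
    ... | yes d = ≤-trans (s≤s z≤n) (≤-reflexive (sym (run-parent d)))
    ... | no ¬d = ≤-reflexive (sym (run-top ¬d))

    run≥2⇒deg2-parent : ∀ {v} → 2 ≤ run v → T (deg2 (parent v))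
    run≥2⇒deg2-parent {v} 2≤run with T? (deg2 (parent v))
    ... | yes d = d
    ... | no ¬d = ⊥-elim (<-irrefl refl (≤-trans 2≤run (≤-reflexive (run-top ¬d))))

    run≡1⇒¬deg2-parent : ∀ {v} → run v ≡ 1 → ¬ T (deg2 (parent v))
    run≡1⇒¬deg2-parent {v} run≡1 d =
      <-irrefl (sym run≡1) (≤-trans (s≤s (run≥1 (parent v))) (≤-reflexive (sym (run-parent d))))

    run-ancestor : ∀ {v} j → T (deg2 v) → j < run v → T (deg2 (ancestor j v)) × run (ancestor j v) + j ≡ run v
    run-ancestor zero d _ = d , +-identityʳ _
    run-ancestor {v} (suc j) d sj<run with run-ancestor j d (<-trans (n<1+n j) sj<run)
    ... | _ , run+j≡ = subst (T ∘ deg2) (sym (ancestor-suc j v)) d-parent , (begin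
      run (ancestor (suc j) v) + suc j       ≡⟨ cong (λ x → run x + suc j) (ancestor-suc j v) ⟩
      run (parent (ancestor j v)) + suc j    ≡⟨ +-suc _ j ⟩
      suc (run (parent (ancestor j v))) + j  ≡⟨ cong (_+ j) (run-parent d-parent) ⟨
      run (ancestor j v) + j                 ≡⟨ run+j≡ ⟩
      run v                                  ∎)
      where
      open ≡-Reasoning
      2≤run : 2 ≤ run (ancestor j v)
      2≤run = +-cancelʳ-≤ j 2 _ (≤-trans sj<run (≤-reflexive (sym run+j≡)))
      d-parent : T (deg2 (parent (ancestor j v)))
      d-parent = run≥2⇒deg2-parent 2≤run

    ancestor-cancel-in-run : ∀ {x y} j → T (deg2 x) → j < run x → ancestor j x ≡ ancestor j y → x ≡ y
    ancestor-cancel-in-run j d j<run eq =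
      ancestor-cancel j eq (λ i _ i≤j → proj₁ (run-ancestor i d (≤-<-trans i≤j j<run)))

    runTop : Fin N → Bool
    runTop v = deg2 v ∧ not (deg2 (parent v))

    belowDeg2 belowOther : Fin N → Bool
    belowDeg2 u = nonRoot u ∧ deg2 (parent u)
    belowOther u = nonRoot u ∧ not (deg2 (parent u))

    count-belowDeg2 : count belowDeg2 ≡ count deg2
    count-belowDeg2 = trans (count-∘-fibres parent nonRoot deg2)
      (sum-cong-≗ λ w → 𝟙*≡𝟙 (deg2 w) deg2⇒children≡1)

    count-belowOther : count belowOther ≡ count branch
    count-belowOther = +-cancelʳ-≡ (count deg2) (count belowOther) (count branch) (begin
      count belowOther + count deg2       ≡⟨ cong (count belowOther +_) count-belowDeg2 ⟨
      count belowOther + count belowDeg2  ≡⟨ +-comm (count belowOther) (count belowDeg2) ⟩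
      count belowDeg2 + count belowOther  ≡⟨ count-split nonRoot (deg2 ∘ parent) ⟨
      count nonRoot                       ≡⟨ count-nonRoot≡branch+deg2 ⟩
      count branch + count deg2           ∎)
      where open ≡-Reasoning

    count-runTop≤count-branch : count runTop ≤ count branch
    count-runTop≤count-branch = ≤-trans (count-mono top⇒belowOther) (≤-reflexive count-belowOther)
      where
      top⇒belowOther : ∀ v → T (runTop v) → T (belowOther v)
      top⇒belowOther v top = let (d , ¬dp) = T-∧⁻ (deg2 v) top in T-∧⁺ (≢⇒not-== (deg2⇒≢root d)) ¬dp

    shortRun : ℕ → Fin N → Bool
    shortRun s v = deg2 v ∧ (run v ≤ᵇ s)

    count-shortRun≤ : ∀ s → count (shortRun s) ≤ s * count runTop
    count-shortRun≤ zero = ≤-reflexive (count-none (shortRun 0) λ v sr →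
      <-irrefl refl (≤-trans (run≥1 v) (≤ᵇ⇒≤ (run v) 0 (proj₂ (T-∧⁻ (deg2 v) sr)))))
    count-shortRun≤ (suc s) = count≤c*count (shortRun (suc s)) runTop top offset maps-to-top injective
      where
      offset : Fin N → Fin (suc s)
      offset v = (run v ∸ 1) mod suc s
      top : Fin N → Fin N
      top v = ancestor (run v ∸ 1) v
      run-1<run : ∀ v → run v ∸ 1 < run v
      run-1<run v = ∸-monoʳ-< z<s (run≥1 v)
      maps-to-top : ∀ v → T (shortRun (suc s) v) → T (runTop (top v))
      maps-to-top v sr with run-ancestor (run v ∸ 1) (proj₁ (T-∧⁻ (deg2 v) sr)) (run-1<run v)
      ... | d , run+≡ = T-∧⁺ d (¬T⇒T-not (run≡1⇒¬deg2-parent run-top≡1))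
        where
        run-top≡1 : run (top v) ≡ 1
        run-top≡1 = +-cancelʳ-≡ (run v ∸ 1) _ _ (trans run+≡ (sym (m+[n∸m]≡n (run≥1 v))))
      injective : ∀ u u' → T (shortRun (suc s) u) → T (shortRun (suc s) u') →
        top u ≡ top u' → offset u ≡ offset u' → u ≡ u'
      injective u u' sr sr' top≡ offset≡ = ancestor-cancel-in-run (run u ∸ 1) (proj₁ (T-∧⁻ (deg2 u) sr)) (run-1<run u)
        (trans top≡ (cong (λ j → ancestor j u') (sym (mod-injective-below (below u sr) (below u' sr') offset≡))))
        where
        below : ∀ v → T (shortRun (suc s) v) → run v ∸ 1 < suc s
        below v sr = s≤s (∸-monoˡ-≤ 1 (≤ᵇ⇒≤ (run v) (suc s) (proj₂ (T-∧⁻ (deg2 v) sr))))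

    module Cuts (t : ℕ) where

      isCut : Fin N → Bool
      isCut v = deg2 v ∧ (run v ≡ᵇ suc t)

      cut⇒deg2 : ∀ {v} → T (isCut v) → T (deg2 v)
      cut⇒deg2 {v} c = proj₁ (T-∧⁻ (deg2 v) c)

      cut⇒run : ∀ {v} → T (isCut v) → run v ≡ suc t
      cut⇒run {v} c = ≡ᵇ⇒≡ (run v) (suc t) (proj₂ (T-∧⁻ (deg2 v) c))

      cut⁺ : ∀ {v} → T (deg2 v) → run v ≡ suc t → T (isCut v)
      cut⁺ {v} d run≡ = T-∧⁺ d (≡⇒≡ᵇ (run v) (suc t) run≡)

      cut⇒≢root : ∀ {v} → T (isCut v) → v ≢ r
      cut⇒≢root c = deg2⇒≢root (cut⇒deg2 c)

      componentFrom : ℕ → Fin N → Fin N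
      componentFrom zero v = if isCut v then v else r
      componentFrom (suc m) v = if isCut v then v else componentFrom m (parent v)

      component : Fin N → Fin N
      component v = componentFrom (depth v) v

      component-cut : ∀ {v} → T (isCut v) → component v ≡ v
      component-cut {v} c = componentFrom-cut (depth v)
        where
        componentFrom-cut : ∀ m → componentFrom m v ≡ v
        componentFrom-cut zero = if-true c
        componentFrom-cut (suc m) = if-true c

      component-nonCut : ∀ {v} → ¬ T (isCut v) → v ≢ r → component v ≡ component (parent v)
      component-nonCut {v} ¬c v≢r =
        trans (cong (λ m → componentFrom m v) (sym (depth-parent v≢r))) (if-false ¬c)

      component-root : component r ≡ r
      component-root = trans (cong (λ m → componentFrom m r) depth-root) (if-false (λ c → cut⇒≢root c refl))

      component-induction : (P : Fin N → Set) → (∀ {v} → T (isCut v) → P v) → P r →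
        (∀ {v} → ¬ T (isCut v) → v ≢ r → P (parent v) → P v) → ∀ v → P v
      component-induction P at-cut at-root at-nonCut = depth-induction P λ v ih → case v ih
        where
        case : ∀ v → (∀ u → depth u < depth v → P u) → P v
        case v ih with T? (isCut v) | v ≟ r
        ... | yes c | _ = at-cut c
        ... | no _ | yes refl = at-root
        ... | no ¬c | no v≢r = at-nonCut ¬c v≢r (ih (parent v) (depth-parent< v≢r))

      component-cases : ∀ v → T (isCut (component v)) ⊎ component v ≡ r
      component-cases = component-induction (λ v → T (isCut (component v)) ⊎ component v ≡ r)
        (λ c → inj₁ (subst (T ∘ isCut) (sym (component-cut c)) c))
        (inj₂ component-root)
        (λ ¬c v≢r ih → subst (λ z → T (isCut z) ⊎ z ≡ r) (sym (component-nonCut ¬c v≢r)) ih)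

      subtree-component : ∀ v → InSubtree (component v) v
      subtree-component = component-induction (λ v → InSubtree (component v) v)
        (λ {v} c → subst (λ z → InSubtree z v) (sym (component-cut c)) (subtree-refl v))
        (subst (λ z → InSubtree z r) (sym component-root) (subtree-refl r))
        (λ {v} ¬c v≢r ih → subst (λ z → InSubtree z v) (sym (component-nonCut ¬c v≢r)) (subtree-child v≢r ih))

      component-nearest : ∀ {b} → T (isCut b) → ∀ v → InSubtree b v → T (isCut (component v)) × InSubtree b (component v)
      component-nearest {b} cb = component-induction Nearest
        (λ c b≤v → subst (λ z → T (isCut z) × InSubtree b z) (sym (component-cut c)) (c , b≤v))
        (λ b≤r → ⊥-elim (cut⇒≢root cb (subtree-of-root b≤r)))
        (λ ¬c v≢r ih b≤v → subst (λ z → T (isCut z) × InSubtree b z) (sym (component-nonCut ¬c v≢r))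
                              (ih (subtree-parent b≤v (λ b≡v → ¬c (subst (T ∘ isCut) b≡v cb)))))
        where
        Nearest : Fin N → Set
        Nearest v = InSubtree b v → T (isCut (component v)) × InSubtree b (component v)

      component-unique : ∀ {x y} → (T (isCut (component x)) → InSubtree (component x) y) →
        (T (isCut (component y)) → InSubtree (component y) x) → component x ≡ component y
      component-unique {x} {y} cx≤y cy≤x with component-cases x | component-cases y
      ... | inj₁ cx | inj₁ cy =
        subtree-antisym (proj₂ (component-nearest cy x (cy≤x cy))) (proj₂ (component-nearest cx y (cx≤y cx)))
      ... | inj₁ cx | inj₂ y↦r = ⊥-elim (cut⇒≢root (proj₁ (component-nearest cx y (cx≤y cx))) y↦r)
      ... | inj₂ x↦r | inj₁ cy = ⊥-elim (cut⇒≢root (proj₁ (component-nearest cy x (cy≤x cy))) x↦r)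
      ... | inj₂ x↦r | inj₂ y↦r = trans x↦r (sym y↦r)

      Separates : Fin N → Fin N → Fin N → Set
      Separates b x y = T (isCut b) × InSubtree b x × ¬ InSubtree b y

      separating-cut : ∀ {x y} → component x ≢ component y →
        (∃ λ b → Separates b x y) ⊎ (∃ λ b → Separates b y x)
      separating-cut {x} {y} cx≢cy with T? (isCut (component x)) ×-dec (¬? (inSubtree? (component x) y))
                                    | T? (isCut (component y)) ×-dec (¬? (inSubtree? (component y) x))
      ... | yes (cx , cx≰y) | _ = inj₁ (component x , cx , subtree-component x , cx≰y)
      ... | no _ | yes (cy , cy≰x) = inj₂ (component y , cy , subtree-component y , cy≰x)
      ... | no ¬sepx | no ¬sepy = ⊥-elim (cx≢cy (component-unique
              (λ cx → decidable-stable (inSubtree? _ y) (λ cx≰y → ¬sepx (cx , cx≰y)))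
              (λ cy → decidable-stable (inSubtree? _ x) (λ cy≰x → ¬sepy (cy , cy≰x)))))

      module Separation {b} (cb : T (isCut b)) where

        deg2-above-cut : ∀ i → i ≤ t → T (deg2 (ancestor i b))
        deg2-above-cut i i≤t =
          proj₁ (run-ancestor i (cut⇒deg2 cb) (subst (i <_) (sym (cut⇒run cb)) (s≤s i≤t)))

        data Level : ℕ → Fin N → Set where
          inside : ∀ {x} → InSubtree b x → Level 0 x
          onChain : ∀ {i} → 0 < i → i ≤ t → Level i (ancestor i b)

        chain-level : ∀ i → i ≤ t → Level i (ancestor i b)
        chain-level zero _ = inside (subtree-refl b)
        chain-level (suc i) si≤t = onChain z<s si≤t

        Outside : Fin N → Set
        Outside y = ¬ InSubtree b y × (∀ i → 0 < i → i ≤ t → y ≢ ancestor i b)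

        level-step : ∀ {x x' i} → Adj G x x' → Level i x → (∃ λ i' → i' ≤ suc i × Level i' x') ⊎ t ≤ i
        level-step xx' lvl with edge-to-parent xx'
        level-step xx' (inside {x} b≤x) | inj₁ (_ , refl) with b ≟ x | 1 ≤? t
        ... | yes refl | yes 1≤t = inj₁ (1 , ≤-refl , onChain z<s 1≤t)
        ... | yes refl | no 1≰t = inj₂ (≤-pred (≰⇒> 1≰t))
        ... | no b≢x | _ = inj₁ (0 , z≤n , inside (subtree-parent b≤x b≢x))
        level-step xx' (onChain {i} 0<i i≤t) | inj₁ (_ , refl) with suc i ≤? t
        ... | yes si≤t = inj₁ (suc i , ≤-refl , subst (Level (suc i)) (ancestor-suc i b) (onChain z<s si≤t))
        ... | no si≰t = inj₂ (≤-pred (≰⇒> si≰t))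
        level-step xx' (inside b≤x) | inj₂ (x'≢r , px'≡x) =
          inj₁ (0 , z≤n , inside (subtree-child x'≢r (subst (InSubtree b) (sym px'≡x) b≤x)))
        level-step {x' = x'} xx' (onChain {suc i} 0<i i≤t) | inj₂ (x'≢r , px'≡x) =
          inj₁ (i , m≤n⇒m≤1+n (n≤1+n i) , lower-level)
          where
          x'≡ : x' ≡ ancestor i b
          x'≡ = unique-child (deg2-above-cut (suc i) i≤t) px'≡x (sym (ancestor-suc i b)) x'≢r
                  (deg2⇒≢root (deg2-above-cut i (≤-trans (n≤1+n i) i≤t)))
          lower-level : Level i x'
          lower-level = subst (Level i) (sym x'≡) (chain-level i (≤-trans (n≤1+n i) i≤t))

        escape-length : ∀ {x y l} → Walk G x y l → ∀ {i} → Level i x → Outside y → suc t ≤ i + l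
        escape-length here (inside b≤y) (b≰y , _) = ⊥-elim (b≰y b≤y)
        escape-length here (onChain {i} 0<i i≤t) (_ , off-chain) = ⊥-elim (off-chain i 0<i i≤t refl)
        escape-length (step {l = l} xx' rest) {i} lvl out with level-step xx' lvl
        ... | inj₁ (i' , i'≤si , lvl') = begin
          suc t      ≤⟨ escape-length rest lvl' out ⟩
          i' + l     ≤⟨ +-monoˡ-≤ l i'≤si ⟩
          suc i + l  ≡⟨ +-suc i l ⟨
          i + suc l  ∎
          where open ≤-Reasoning
        ... | inj₂ t≤i = ≤-trans (s≤s t≤i) (≤-trans (m≤m+n (suc i) l) (≤-reflexive (sym (+-suc i l))))

        leaves-separated : ∀ {ℓ ℓ'} → T (leaf ℓ) → T (leaf ℓ') → InSubtree b ℓ → ¬ InSubtree b ℓ' →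
          DistAtLeast G (suc (suc t)) ℓ ℓ'
        leaves-separated l l' b≤ℓ b≰ℓ' .0 here = ⊥-elim (b≰ℓ' b≤ℓ)
        leaves-separated {ℓ} {ℓ'} l l' b≤ℓ b≰ℓ' (suc _) (step ℓx rest) with edge-to-parent ℓx
        ... | inj₁ (_ , pℓ≡x) = s≤s (escape-length rest (inside (subst (InSubtree b) pℓ≡x b≤pℓ)) outside)
          where
          b≢ℓ : b ≢ ℓ
          b≢ℓ b≡ℓ = leaf⇒¬deg2 l (subst (T ∘ deg2) b≡ℓ (cut⇒deg2 cb))
          b≤pℓ : InSubtree b (parent ℓ)
          b≤pℓ = subtree-parent b≤ℓ b≢ℓ
          outside : Outside ℓ'
          outside = b≰ℓ' , λ i _ i≤t ℓ'≡ → leaf⇒¬deg2 l' (subst (T ∘ deg2) (sym ℓ'≡) (deg2-above-cut i i≤t))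
        ... | inj₂ (x≢r , px≡ℓ) = ⊥-elim (leaf-childless l ℓ≢r px≡ℓ x≢r)
          where
          ℓ≢r : ℓ ≢ r
          ℓ≢r ℓ≡r = cut⇒≢root cb (subtree-of-root (subst (InSubtree b) ℓ≡r b≤ℓ))

      inComponent : Fin N → Fin N → Bool
      inComponent b v = b == component v

      cutsBelow : Fin N → ℕ
      cutsBelow b = count (inFibre (component ∘ parent) isCut b)

      ∑-cutsBelow : ∑[ b < N ] cutsBelow b ≡ count isCut
      ∑-cutsBelow = sym (count-fibres (component ∘ parent) isCut)

      module LeaflessComponent {b} (cb : T (isCut b)) (leafless : ∀ ℓ → T (leaf ℓ) → component ℓ ≢ b) where

        member : Fin N → Bool
        member = inComponent b

        member⁻ : ∀ {v} → T (member v) → component v ≡ b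
        member⁻ {v} m = sym (==⇒≡ {i = b} {component v} m)

        member⁺ : ∀ {v} → component v ≡ b → T (member v)
        member⁺ cv≡b = ≡⇒== (sym cv≡b)

        member⇒≢root : ∀ {v} → T (member v) → v ≢ r
        member⇒≢root m refl = cut⇒≢root cb (trans (sym (member⁻ m)) component-root)

        member-parent : ∀ {v} → T (member v) → ¬ T (isCut v) → T (member (parent v))
        member-parent m ¬c = member⁺ (trans (sym (component-nonCut ¬c (member⇒≢root m))) (member⁻ m))

        member-children≥1 : ∀ {v} → T (member v) → 1 ≤ children v
        member-children≥1 {v} m with children v | degree-nonRoot (member⇒≢root m)
        ... | zero | degree≡1 = ⊥-elim (leafless v (≡⇒≡ᵇ (degree G v) 1 degree≡1) (member⁻ m))
        ... | suc _ | _ = s≤s z≤n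

        memberCut memberNonCut : Fin N → Bool
        memberCut v = member v ∧ isCut v
        memberNonCut v = member v ∧ not (isCut v)

        count-memberCut : count memberCut ≡ 1
        count-memberCut = ≤-antisym
          (count≤1 _ λ x y mx my → trans (sym (memberCut≡b mx)) (memberCut≡b my))
          (count≥1 _ b (T-∧⁺ (member⁺ (component-cut cb)) cb))
          where
          memberCut≡b : ∀ {v} → T (memberCut v) → b ≡ v
          memberCut≡b {v} mc = let (m , c) = T-∧⁻ (member v) mc in trans (sym (member⁻ m)) (component-cut c)

        𝟙-child-of-member : ∀ u → 𝟙 (nonRoot u ∧ member (parent u)) ≡
          𝟙 (inFibre (component ∘ parent) isCut b u) + 𝟙 (memberNonCut u)
        𝟙-child-of-member u = 𝟙-exclusive-∨ split cut-child member-child exclusive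
          where
          split : T (nonRoot u ∧ member (parent u)) → T (member (parent u) ∧ isCut u) ⊎ T (memberNonCut u)
          split nr∧m with T-∧⁻ (nonRoot u) nr∧m | T? (isCut u)
          ... | _ , m | yes c = inj₁ (T-∧⁺ m c)
          ... | nr , m | no ¬c = inj₂ (T-∧⁺ (member⁺ (trans (component-nonCut ¬c (not-==⇒≢ nr)) (member⁻ m)))
                                           (¬T⇒T-not ¬c))
          cut-child : T (member (parent u) ∧ isCut u) → T (nonRoot u ∧ member (parent u))
          cut-child m∧c = let (m , c) = T-∧⁻ (member (parent u)) m∧c in T-∧⁺ (≢⇒not-== (cut⇒≢root c)) m
          member-child : T (memberNonCut u) → T (nonRoot u ∧ member (parent u))
          member-child m∧¬c = let (m , ¬c) = T-∧⁻ (member u) m∧¬c in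
            T-∧⁺ (≢⇒not-== (member⇒≢root m)) (member-parent m (T-not⇒¬T ¬c))
          exclusive : T (member (parent u) ∧ isCut u) → ¬ T (memberNonCut u)
          exclusive m∧c m∧¬c = T-not⇒¬T (proj₂ (T-∧⁻ (member u) m∧¬c)) (proj₂ (T-∧⁻ (member (parent u)) m∧c))

        childrenOfMembers : ℕ
        childrenOfMembers = ∑[ v < N ] (𝟙 (member v) * children v)

        -- Every child of a member is either a cut hanging below the component or a member other than b.
        edge-identity : childrenOfMembers + 1 ≡ cutsBelow b + count member
        edge-identity = begin
          childrenOfMembers + 1                                        ≡⟨ cong (_+ 1) children≡ ⟨
          cutsBelow b + count memberNonCut + 1                         ≡⟨ +-assoc (cutsBelow b) _ 1 ⟩
          cutsBelow b + (count memberNonCut + 1)                       ≡⟨ cong (cutsBelow b +_) (+-comm _ 1) ⟩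
          cutsBelow b + (1 + count memberNonCut)
            ≡⟨ cong (λ x → cutsBelow b + (x + count memberNonCut)) count-memberCut ⟨
          cutsBelow b + (count memberCut + count memberNonCut)         ≡⟨ cong (cutsBelow b +_) (count-split member isCut) ⟨
          cutsBelow b + count member                                   ∎
          where
          open ≡-Reasoning
          children≡ : cutsBelow b + count memberNonCut ≡ childrenOfMembers
          children≡ = begin
            cutsBelow b + count memberNonCut
              ≡⟨ ∑-distrib-+ (𝟙 ∘ inFibre (component ∘ parent) isCut b) (𝟙 ∘ memberNonCut) ⟨
            ∑[ u < N ] (𝟙 (inFibre (component ∘ parent) isCut b u) + 𝟙 (memberNonCut u))
                                                        ≡⟨ sum-cong-≗ 𝟙-child-of-member ⟨
            count (λ u → nonRoot u ∧ member (parent u)) ≡⟨ count-∘-fibres parent nonRoot member ⟩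
            childrenOfMembers                           ∎

        -- If all members had degree 2, runs would only grow inside the component, so no cut could hang below it.
        not-a-path : ¬ (∀ v → T (member v) → T (deg2 v))
        not-a-path all-deg2 = <-irrefl (sym count+1≡count) (≤-reflexive (+-comm 1 (count member)))
          where
          long-run : ∀ x → T (member x) → suc t ≤ run x
          long-run = depth-induction _ λ x ih m → case x ih m
            where
            case : ∀ x → (∀ u → depth u < depth x → T (member u) → suc t ≤ run u) → T (member x) → suc t ≤ run x
            case x ih m with T? (isCut x)
            ... | yes c = ≤-reflexive (sym (cut⇒run c))
            ... | no ¬c = let mp = member-parent m ¬c in begin
              suc t                   ≤⟨ n≤1+n _ ⟩
              suc (suc t)             ≤⟨ s≤s (ih (parent x) (depth-parent< (member⇒≢root m)) mp) ⟩
              suc (run (parent x))    ≡⟨ run-parent (all-deg2 _ mp) ⟨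
              run x                   ∎
              where open ≤-Reasoning
          no-cuts-below : cutsBelow b ≡ 0
          no-cuts-below = count-none _ λ u below →
            let (pu↦b , c) = inFibre⁻ (component ∘ parent) isCut b u below ; mp = member⁺ pu↦b in
            <-irrefl (sym (cut⇒run c))
                     (≤-trans (s≤s (long-run (parent u) mp)) (≤-reflexive (sym (run-parent (all-deg2 _ mp)))))
          childrenOfMembers≡ : childrenOfMembers ≡ count member
          childrenOfMembers≡ = sum-cong-≗ λ v → 𝟙*≡𝟙 (member v) (λ m → deg2⇒children≡1 (all-deg2 v m))
          count+1≡count : count member + 1 ≡ count member
          count+1≡count = trans (cong (_+ 1) (sym childrenOfMembers≡))
                                (trans edge-identity (cong (_+ count member) no-cuts-below))

        cutsBelow≥2 : 2 ≤ cutsBelow b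
        cutsBelow≥2 with any? (λ v → T? (member v) ×-dec (2 ≤? children v))
        ... | no none = ⊥-elim (not-a-path λ v m → deg2⁺ (member⇒≢root m) (trans (degree-nonRoot (member⇒≢root m))
                          (cong suc (≤-antisym (≮⇒≥ λ 1<c → none (v , m , 1<c)) (member-children≥1 m)))))
        ... | yes (v₀ , m₀ , 2≤c₀) = +-cancelʳ-≤ (count member) 2 (cutsBelow b) (begin
          2 + count member                          ≡⟨ trans (+-comm 2 _) (sym (+-assoc _ 1 1)) ⟩
          count member + 1 + 1                      ≡⟨ cong (λ x → count member + x + 1) (count-== v₀) ⟨
          count member + count (_== v₀) + 1         ≡⟨ cong (_+ 1) (∑-distrib-+ (𝟙 ∘ member) (𝟙 ∘ (_== v₀))) ⟨
          ∑[ v < N ] (𝟙 (member v) + 𝟙 (v == v₀)) + 1  ≤⟨ +-monoˡ-≤ 1 (∑-mono-≤ pointwise) ⟩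
          childrenOfMembers + 1                     ≡⟨ edge-identity ⟩
          cutsBelow b + count member                ∎)
          where
          open ≤-Reasoning
          pointwise : ∀ v → 𝟙 (member v) + 𝟙 (v == v₀) ≤ 𝟙 (member v) * children v
          pointwise v with v ≟ v₀ | T? (member v)
          ... | yes refl | _ = subst (λ x → x + 1 ≤ x * children v₀) (sym (𝟙-true m₀))
                                     (≤-trans 2≤c₀ (≤-reflexive (sym (+-identityʳ _))))
          ... | no _ | yes m = subst (λ x → x + 0 ≤ x * children v) (sym (𝟙-true m))
                                     (≤-trans (member-children≥1 m) (≤-reflexive (sym (+-identityʳ _))))
          ... | no _ | no ¬m = subst (λ x → x + 0 ≤ x * children v) (sym (𝟙-false ¬m)) z≤n

      leafIn? : ∀ b → Dec (∃ λ ℓ → T (leaf ℓ) × component ℓ ≡ b)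
      leafIn? b = any? (λ ℓ → T? (leaf ℓ) ×-dec (component ℓ ≟ b))

      leafy : Fin N → Bool
      leafy b = does (leafIn? b)

      leafy⁺ : ∀ {b ℓ} → T (leaf ℓ) → component ℓ ≡ b → T (leafy b)
      leafy⁺ {b} {ℓ} l ℓ↦b with leafIn? b
      ... | yes _ = _
      ... | no none = none (ℓ , l , ℓ↦b)

      representative : Fin N → Fin N
      representative b with leafIn? b
      ... | yes (ℓ , _) = ℓ
      ... | no _ = b

      representative-leaf : ∀ {b} → T (leafy b) → T (leaf (representative b)) × component (representative b) ≡ b
      representative-leaf {b} _ with leafIn? b
      ... | yes (_ , l , ℓ↦b) = l , ℓ↦b

      isRepresentative : Fin N → Bool
      isRepresentative ℓ = leaf ℓ ∧ (representative (component ℓ) == ℓ)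

      representatives-apart : ∀ {ℓ ℓ'} → T (isRepresentative ℓ) → T (isRepresentative ℓ') →
        component ℓ ≡ component ℓ' → ℓ ≡ ℓ'
      representatives-apart {ℓ} {ℓ'} rep rep' same = begin
        ℓ                               ≡⟨ ==⇒≡ (proj₂ (T-∧⁻ (leaf ℓ) rep)) ⟨
        representative (component ℓ)    ≡⟨ cong representative same ⟩
        representative (component ℓ')   ≡⟨ ==⇒≡ (proj₂ (T-∧⁻ (leaf ℓ') rep')) ⟩
        ℓ'                              ∎
        where open ≡-Reasoning

      count-cuts≤2*count-representatives : count isCut ≤ 2 * count isRepresentative
      count-cuts≤2*count-representatives = begin
        count isCut                  ≡⟨ count-split isCut leafy ⟩
        leafyCuts + leaflessCuts     ≤⟨ +-monoʳ-≤ leafyCuts leafless≤leafy ⟩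
        leafyCuts + leafyCuts        ≡⟨ cong (leafyCuts +_) (+-identityʳ leafyCuts) ⟨
        2 * leafyCuts                ≤⟨ *-monoʳ-≤ 2 leafy≤representatives ⟩
        2 * count isRepresentative   ∎
        where
        open ≤-Reasoning
        leaflessCut : Fin N → Bool
        leaflessCut b = isCut b ∧ not (leafy b)
        leafyCuts leaflessCuts : ℕ
        leafyCuts = count (λ b → isCut b ∧ leafy b)
        leaflessCuts = count leaflessCut
        2*𝟙≤cutsBelow : ∀ b → 2 * 𝟙 (leaflessCut b) ≤ cutsBelow b
        2*𝟙≤cutsBelow b with T? (leaflessCut b)
        ... | no ¬lc = ≤-trans (≤-reflexive (cong (2 *_) (𝟙-false ¬lc))) z≤n
        ... | yes lc = let (cb , ¬l) = T-∧⁻ (isCut b) lc in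
          ≤-trans (≤-reflexive (cong (2 *_) (𝟙-true lc)))
                  (LeaflessComponent.cutsBelow≥2 cb (λ ℓ l ℓ↦b → T-not⇒¬T ¬l (leafy⁺ l ℓ↦b)))
        leafless≤leafy : leaflessCuts ≤ leafyCuts
        leafless≤leafy = +-cancelʳ-≤ leaflessCuts leaflessCuts leafyCuts (begin
          leaflessCuts + leaflessCuts            ≡⟨ cong (leaflessCuts +_) (+-identityʳ leaflessCuts) ⟨
          2 * leaflessCuts                       ≡⟨ *-distribˡ-∑ 2 (𝟙 ∘ leaflessCut) ⟩
          ∑[ b < N ] (2 * 𝟙 (leaflessCut b))     ≤⟨ ∑-mono-≤ 2*𝟙≤cutsBelow ⟩
          ∑[ b < N ] cutsBelow b                 ≡⟨ ∑-cutsBelow ⟩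
          count isCut                            ≡⟨ count-split isCut leafy ⟩
          leafyCuts + leaflessCuts               ∎)
        leafy≤representatives : leafyCuts ≤ count isRepresentative
        leafy≤representatives = count≤count-injective _ isRepresentative representative
          (λ b lc → let (l , ℓ↦b) = representative-leaf (proj₂ (T-∧⁻ (isCut b) lc)) in
                    T-∧⁺ l (≡⇒== (cong representative ℓ↦b)))
          (λ b b' lc lc' same → trans (sym (proj₂ (representative-leaf (proj₂ (T-∧⁻ (isCut b) lc)))))
                                  (trans (cong component same) (proj₂ (representative-leaf (proj₂ (T-∧⁻ (isCut b') lc'))))))

      module Paths (k : ℕ) where

        longRun : Fin N → Bool
        longRun v = deg2 v ∧ not (run v ≤ᵇ t)

        longRun⇒deg2 : ∀ {v} → T (longRun v) → T (deg2 v)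
        longRun⇒deg2 {v} lr = proj₁ (T-∧⁻ (deg2 v) lr)

        longRun⇒t<run : ∀ {v} → T (longRun v) → t < run v
        longRun⇒t<run {v} lr = not-≤ᵇ⇒> (proj₂ (T-∧⁻ (deg2 v) lr))

        height : Fin N → ℕ
        height v = run v ∸ suc t

        run≡height : ∀ {v} → T (longRun v) → run v ≡ suc t + height v
        run≡height lr = sym (m+[n∸m]≡n (longRun⇒t<run lr))

        marked : Fin N → Bool
        marked v = longRun v ∧ (height v % suc k ≡ᵇ 0)

        target : Fin N → Fin N
        target v = ancestor (height v % suc k) v

        offset<run : ∀ {v} → T (longRun v) → height v % suc k < run v
        offset<run {v} lr = begin-strict
          height v % suc k   ≤⟨ m%n≤m (height v) (suc k) ⟩
          height v           <⟨ s≤s (m≤n+m (height v) t) ⟩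
          suc t + height v   ≡⟨ run≡height lr ⟨
          run v              ∎
          where open ≤-Reasoning

        run-target : ∀ {v} → T (longRun v) → run (target v) ≡ suc t + (height v / suc k) * suc k
        run-target {v} lr = +-cancelʳ-≡ (height v % suc k) _ _ (begin
          run (target v) + h % M      ≡⟨ proj₂ (run-ancestor _ (longRun⇒deg2 lr) (offset<run lr)) ⟩
          run v                       ≡⟨ run≡height lr ⟩
          suc t + h                   ≡⟨ cong (suc t +_) (m≡m%n+[m/n]*n h M) ⟩
          suc t + (h % M + h / M * M) ≡⟨ cong (suc t +_) (+-comm (h % M) (h / M * M)) ⟩
          suc t + (h / M * M + h % M) ≡⟨ +-assoc (suc t) _ _ ⟨
          suc t + h / M * M + h % M   ∎)
          where
          open ≡-Reasoning
          h = height v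
          M = suc k

        target-marked : ∀ {v} → T (longRun v) → T (marked (target v))
        target-marked {v} lr = T-∧⁺ (T-∧⁺ deg2-target (>⇒not-≤ᵇ t<run)) (≡⇒≡ᵇ _ 0 height%≡0)
          where
          deg2-target : T (deg2 (target v))
          deg2-target = proj₁ (run-ancestor _ (longRun⇒deg2 lr) (offset<run lr))
          t<run : t < run (target v)
          t<run = ≤-trans (m≤m+n (suc t) _) (≤-reflexive (sym (run-target lr)))
          height%≡0 : height (target v) % suc k ≡ 0
          height%≡0 = begin
            (run (target v) ∸ suc t) % suc k                         ≡⟨ cong (λ x → (x ∸ suc t) % suc k) (run-target lr) ⟩
            (suc t + height v / suc k * suc k ∸ suc t) % suc k       ≡⟨ cong (_% suc k) (m+n∸m≡n (suc t) _) ⟩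
            (height v / suc k * suc k) % suc k                       ≡⟨ m*n%n≡0 (height v / suc k) (suc k) ⟩
            0                                                        ∎
            where open ≡-Reasoning

        count-longRun≤ : count longRun ≤ suc k * count marked
        count-longRun≤ = count≤c*count longRun marked target (λ v → height v mod suc k) (λ v → target-marked) injective
          where
          injective : ∀ u u' → T (longRun u) → T (longRun u') → target u ≡ target u' →
            height u mod suc k ≡ height u' mod suc k → u ≡ u'
          injective u u' lr lr' same-target same-offset = ancestor-cancel-in-run _ (longRun⇒deg2 lr) (offset<run lr)
            (trans same-target (cong (λ j → ancestor j u') (sym (mod-injective {height u} {height u'} same-offset))))

        pathStart : Fin N → Bool
        pathStart v = marked v ∧ not (isCut v)

        count-marked≤ : count marked ≤ count isCut + count pathStart
        count-marked≤ = ≤-trans (≤-reflexive (count-split marked isCut))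
          (+-monoˡ-≤ (count pathStart) (count-mono (λ v m∧c → proj₂ (T-∧⁻ (marked v) m∧c))))

        pathStart⇒longRun : ∀ {v} → T (pathStart v) → T (longRun v)
        pathStart⇒longRun {v} ps = proj₁ (T-∧⁻ (longRun v) (proj₁ (T-∧⁻ (marked v) ps)))

        pathStart⇒deg2 : ∀ {v} → T (pathStart v) → T (deg2 v)
        pathStart⇒deg2 ps = longRun⇒deg2 (pathStart⇒longRun ps)

        run-pathStart : ∀ {v} → T (pathStart v) → run v ≡ suc t + (height v / suc k) * suc k
        run-pathStart {v} ps = begin
          run v                                          ≡⟨ run≡height (pathStart⇒longRun ps) ⟩
          suc t + height v                               ≡⟨ cong (suc t +_) (m≡m%n+[m/n]*n (height v) (suc k)) ⟩
          suc t + (height v % suc k + height v / suc k * suc k)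
                                                         ≡⟨ cong (λ x → suc t + (x + height v / suc k * suc k)) height%≡0 ⟩
          suc t + height v / suc k * suc k               ∎
          where
          open ≡-Reasoning
          height%≡0 : height v % suc k ≡ 0
          height%≡0 = ≡ᵇ⇒≡ _ 0 (proj₂ (T-∧⁻ (longRun v) (proj₁ (T-∧⁻ (marked v) ps))))

        pathStart⇒k<run : ∀ {v} → T (pathStart v) → k < run v
        pathStart⇒k<run {v} ps = from-run (height v / suc k) (run-pathStart ps)
          where
          from-run : ∀ q → run v ≡ suc t + q * suc k → k < run v
          from-run zero run≡ = ⊥-elim (T-not⇒¬T (proj₂ (T-∧⁻ (marked v) ps))
            (cut⁺ {v} (pathStart⇒deg2 ps) (trans run≡ (+-identityʳ (suc t)))))
          from-run (suc q) run≡ = begin-strict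
            k                        <⟨ m≤m+n (suc k) (q * suc k) ⟩
            suc q * suc k            ≤⟨ m≤n+m _ (suc t) ⟩
            suc t + suc q * suc k    ≡⟨ run≡ ⟨
            run v                    ∎
            where open ≤-Reasoning

        barePath : Fin N → List (Fin N)
        barePath v = applyUpTo (λ i → ancestor i v) (suc k)

        deg2-on-barePath : ∀ {v} → T (pathStart v) → ∀ i → i ≤ k → T (deg2 (ancestor i v))
        deg2-on-barePath ps i i≤k = proj₁ (run-ancestor i (pathStart⇒deg2 ps) (≤-<-trans i≤k (pathStart⇒k<run ps)))

        barePath-isBare : ∀ {v} → T (pathStart v) → IsBarePath G k (barePath v)
        barePath-isBare {v} ps = (unique , linked) , length-applyUpTo above-v (suc k) , interior-deg2
          where
          above-v : ℕ → Fin N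
          above-v i = ancestor i v
          k<depth : k < depth v
          k<depth = ancestor≢root⇒< (deg2⇒≢root (deg2-on-barePath {v} ps k ≤-refl))
          unique : Unique (barePath v)
          unique = Uniqueₚ.applyUpTo⁺₁ above-v (suc k) λ i<j j<sk →
            ancestor-injective i<j (≤-trans (≤-pred j<sk) (<⇒≤ k<depth))
          linked : Linked (Adj G) (barePath v)
          linked = Linkedₚ.applyUpTo⁺₁ above-v (suc k) λ {i} si<sk →
            adj-ancestor {i} {v} (<-trans (≤-pred si<sk) k<depth)
          interior-deg2 : All (λ u → degree G u ≡ 2) (interior G (barePath v))
          interior-deg2 = Allₚ.take⁺ _ (Allₚ.drop⁺ 1 (Allₚ.applyUpTo⁺₁ above-v (suc k) λ {i} i<sk →
            deg2⇒degree≡2 (deg2-on-barePath {v} ps i (≤-pred i<sk))))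

        -- Along a run, run (ancestor i v) + i is constant, and at path starts it is suc t plus a multiple of suc k.
        barePaths-meet⇒same-start : ∀ {v v'} → T (pathStart v) → T (pathStart v') → ∀ {i i'} → i ≤ k → i' ≤ k →
          ancestor i v ≡ ancestor i' v' → v ≡ v'
        barePaths-meet⇒same-start {v} {v'} ps ps' {i} {i'} i≤k i'≤k meet =
          ancestor-cancel-in-run i (pathStart⇒deg2 ps) i<run (trans meet (cong (λ j → ancestor j v') (sym i≡i')))
          where
          i<run : i < run v
          i<run = ≤-<-trans i≤k (pathStart⇒k<run ps)
          on-v : run (ancestor i v) + i ≡ suc t + (height v / suc k) * suc k
          on-v = trans (proj₂ (run-ancestor i (pathStart⇒deg2 ps) i<run)) (run-pathStart ps)
          on-v' : run (ancestor i v) + i' ≡ suc t + (height v' / suc k) * suc k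
          on-v' = trans (cong (λ x → run x + i') meet)
            (trans (proj₂ (run-ancestor i' (pathStart⇒deg2 ps') (≤-<-trans i'≤k (pathStart⇒k<run ps'))))
                   (run-pathStart ps'))
          i≡i' : i ≡ i'
          i≡i' with ≤-total i i'
          ... | inj₁ i≤i' = offset-unique-mod (suc t) _ (height v / suc k) (height v' / suc k) i≤i' (s≤s i'≤k) on-v on-v'
          ... | inj₂ i'≤i = sym (offset-unique-mod (suc t) _ (height v' / suc k) (height v / suc k) i'≤i (s≤s i≤k) on-v' on-v)

        barePaths-disjoint : ∀ {v v'} → T (pathStart v) → T (pathStart v') → v ≢ v' → Disjoint (barePath v) (barePath v')
        barePaths-disjoint {v} {v'} ps ps' v≢v' (x∈ , x∈')
          with ∈-applyUpTo⁻ (λ i → ancestor i v) x∈ | ∈-applyUpTo⁻ (λ i → ancestor i v') x∈'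
        ... | i , i<sk , refl | i' , i'<sk , meet =
          v≢v' (barePaths-meet⇒same-start ps ps' (≤-pred i<sk) (≤-pred i'<sk) meet)

    module Decomposition (t k : ℕ) where
      open Cuts t public
      open Paths k public

      vertex-bound : N ≤ suc (2 * count leaf + t * (2 * count leaf) + suc k * (2 * count isRepresentative + count pathStart))
      vertex-bound = begin
        N                                                          ≡⟨ count-nonRoot ⟨
        suc (count nonRoot)                                        ≡⟨ cong suc count-nonRoot≡branch+deg2 ⟩
        suc (count branch + count deg2)                            ≡⟨ cong (λ x → suc (count branch + x)) deg2-split ⟩
        suc (count branch + (count (shortRun t) + count longRun))  ≡⟨ cong suc (+-assoc (count branch) _ _) ⟨
        suc (count branch + count (shortRun t) + count longRun)
          ≤⟨ s≤s (+-mono-≤ (+-mono-≤ count-branch≤2*count-leaf short≤) long≤) ⟩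
        suc (2 * count leaf + t * (2 * count leaf) + suc k * (2 * count isRepresentative + count pathStart)) ∎
        where
        open ≤-Reasoning
        deg2-split : count deg2 ≡ count (shortRun t) + count longRun
        deg2-split = count-split deg2 (λ v → run v ≤ᵇ t)
        short≤ : count (shortRun t) ≤ t * (2 * count leaf)
        short≤ = ≤-trans (count-shortRun≤ t) (*-monoʳ-≤ t (≤-trans count-runTop≤count-branch count-branch≤2*count-leaf))
        long≤ : count longRun ≤ suc k * (2 * count isRepresentative + count pathStart)
        long≤ = ≤-trans count-longRun≤ (*-monoʳ-≤ (suc k)
                  (≤-trans count-marked≤ (+-monoˡ-≤ (count pathStart) count-cuts≤2*count-representatives)))

      representatives : List (Fin N)
      representatives = filter (T? ∘ isRepresentative) (allFin N)

      length-representatives : length representatives ≡ count isRepresentative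
      length-representatives = length-filter isRepresentative

      representatives-unique : Unique representatives
      representatives-unique = Uniqueₚ.filter⁺ (T? ∘ isRepresentative) (Uniqueₚ.allFin⁺ N)

      ∈-representatives⁻ : ∀ {ℓ} → ℓ ∈ representatives → T (isRepresentative ℓ)
      ∈-representatives⁻ ℓ∈ = proj₂ (∈-filter⁻ (T? ∘ isRepresentative) {xs = allFin N} ℓ∈)

      representative⇒leaf : ∀ {ℓ} → T (isRepresentative ℓ) → T (leaf ℓ)
      representative⇒leaf {ℓ} rep = proj₁ (T-∧⁻ (leaf ℓ) rep)

      representatives-leaves : All (IsLeaf G) representatives
      representatives-leaves = All.tabulate (leaf⇒degree≡1 ∘ representative⇒leaf ∘ ∈-representatives⁻)

      representatives-separated : Separated G (suc (suc t)) representatives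
      representatives-separated u v u∈ v∈ u≢v with ∈-representatives⁻ u∈ | ∈-representatives⁻ v∈
      ... | rep-u | rep-v with separating-cut (u≢v ∘ representatives-apart rep-u rep-v)
      ...   | inj₁ (b , cb , b≤u , b≰v) =
        Separation.leaves-separated cb (representative⇒leaf rep-u) (representative⇒leaf rep-v) b≤u b≰v
      ...   | inj₂ (b , cb , b≤v , b≰u) = λ l walk →
        Separation.leaves-separated cb (representative⇒leaf rep-v) (representative⇒leaf rep-u) b≤v b≰u l (walk-reverse walk)

      starts : List (Fin N)
      starts = filter (T? ∘ pathStart) (allFin N)

      starts-pathStart : All (T ∘ pathStart) starts
      starts-pathStart = Allₚ.all-filter (T? ∘ pathStart) (allFin N)

      barePaths : List (List (Fin N))
      barePaths = map barePath starts

      length-barePaths : length barePaths ≡ count pathStart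
      length-barePaths = trans (length-map barePath starts) (length-filter pathStart)

      barePaths-bare : All (IsBarePath G k) barePaths
      barePaths-bare = Allₚ.map⁺ (All.map barePath-isBare starts-pathStart)

      barePaths-disjoint-union : Unique (concat barePaths)
      barePaths-disjoint-union = Uniqueₚ.concat⁺
        (Allₚ.map⁺ (All.map (proj₁ ∘ proj₁ ∘ barePath-isBare) starts-pathStart))
        (AllPairsₚ.map⁺ (allPairs-restrict starts-pathStart starts-unique barePaths-disjoint))
        where
        starts-unique : Unique starts
        starts-unique = Uniqueₚ.filter⁺ (T? ∘ pathStart) (Uniqueₚ.allFin⁺ N)

open import Data.Nat using (zero; suc; _∸_; _≤?_)
open import Data.Nat.Properties using (≤-trans; m+[n∸m]≡n; *-monoʳ-≤; ≰⇒>)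
open import Data.Fin using (zero)
open import Data.Product using (_,_)
open import Data.Sum using (inj₁; inj₂)
open import Data.Empty using (⊥-elim)
open import Function using (_∘_)
open import Relation.Nullary using (Dec; yes; no)
open import Relation.Binary.PropositionalEquality using (_≡_; subst; sym)
open Counting using (𝟙; count; sum-allFin)
open Arithmetic using (1≤d⇒4d≤k⇒1≤k; counting-contradiction)
open Trees using (module RootedTree)

Outcome : (n k d : ℕ) → Graph n → Set
Outcome n k d G =
  (Σ (List (Fin n)) λ Q → Unique Q × All (IsLeaf G) Q × Separated G (2 * d) Q × n ≤ 40 * k * length Q)
  ⊎ (Σ (List (List (Fin n))) λ P → All (IsBarePath G k) P × Unique (concat P) × n ≤ 40 * k * length P)

lemma3p16 : (n k d : ℕ) → 1 ≤ d → 60 * k ≤ n → 4 * d ≤ k →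
    (G : Graph n) → IsTree G → 5 * d * leafCount G ≤ n →
    (Σ (List (Fin n)) λ Q →
        Unique Q × All (IsLeaf G) Q × Separated G (2 * d) Q × n ≤ 40 * k * length Q)
    ⊎ (Σ (List (List (Fin n))) λ P →
        All (IsBarePath G k) P × Unique (concat P) × n ≤ 40 * k * length P)
lemma3p16 zero k d 1≤d 60k≤0 4d≤k G _ _ with ≤-trans (*-monoʳ-≤ 60 (1≤d⇒4d≤k⇒1≤k 1≤d 4d≤k)) 60k≤0
... | ()
lemma3p16 n@(suc _) k d 1≤d 60k≤n 4d≤k G tree few-leaves =
  decide (n ≤? 40 * k * count isRepresentative) (n ≤? 40 * k * count pathStart)
  where
  open RootedTree G tree zero
  t+2≡2d : 2 + (2 * d ∸ 2) ≡ 2 * d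
  t+2≡2d = m+[n∸m]≡n (*-monoʳ-≤ 2 1≤d)
  open Decomposition (2 * d ∸ 2) k
  decide : Dec (n ≤ 40 * k * count isRepresentative) → Dec (n ≤ 40 * k * count pathStart) → Outcome n k d G
  decide (yes many-reps) _ = inj₁ (representatives , representatives-unique , representatives-leaves ,
    subst (λ m → Separated G m representatives) t+2≡2d representatives-separated ,
    subst (λ m → n ≤ 40 * k * m) (sym length-representatives) many-reps)
  decide (no _) (yes many-paths) = inj₂ (barePaths , barePaths-bare , barePaths-disjoint-union ,
    subst (λ m → n ≤ 40 * k * m) (sym length-barePaths) many-paths)
  decide (no few-reps) (no few-paths) = ⊥-elim (counting-contradiction 1≤d 60k≤n 4d≤k
    (subst (λ L → 5 * d * L ≤ n) (sum-allFin n (𝟙 ∘ leaf)) few-leaves) t+2≡2d vertex-bound (≰⇒> few-reps) (≰⇒> few-paths))
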